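{- Let $\Sigma$ and $\Gamma$ be arbitrary classes of structures (not necessarily list types). Let $B_0 \in \Gamma$ be a fixed structure (the initial state) and let $\delta : \Gamma \times \Sigma \to \Gamma$ be a quantifier-free interpretation. Then the function $\Sigma^* \to \Gamma$ obtained by folding, i.e. $[A_1,\ldots,A_n] \mapsto B_n$ where $B_i = \delta(B_{i-1}, A_i)$ for $i = 1,\ldots,n$, is a linear MSO interpretation.
   Context: A vocabulary is a finite set of relation names with arities in $\{0,1,\ldots\}$ (nullary relations allowed); a structure consists of a finite, possibly empty, universe and an interpretation of the vocabulary. A class of structures consists of structures over one vocabulary and is closed under isomorphism. Constructions on classes: the class $\Sigma_1 \times \Sigma_2$ has as vocabulary the disjoint union of the two vocabularies plus a new unary relation; its structures are disjoint unions of a structure of $\Sigma_1$ and one of $\Sigma_2$, with the unary relation selecting the elements coming from the first one. The class $\Sigma^*$ consists of structures obtained from a list $[A_1,\ldots,A_n]$ of nonempty structures of $\Sigma$ by taking their disjoint union, adding a binary relation $x \le y$ which holds iff the list item containing $x$ appears no later than the one containing $y$, and replacing every nullary relation $R()$ of $\Sigma$ by a unary relation $R(x)$ selecting the elements whose list item satisfies $R()$. A polynomial functor is an operation on sets of the form $F(A) = A^{k_1} + \cdots + A^{k_n}$; each $A^{k_i}$ is a component of dimension $k_i$. An MSO query of type $F$ is a family of MSO formulas, one per component, the formula for component $A^{k_i}$ having $k_i$ free variables. A function $f : \Sigma \to \Gamma$ between classes of structures is an MSO interpretation if there is a polynomial functor $F$ such that (1) there is an MSO query of type $F$ which, evaluated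 in every input structure $A$, defines the universe of $f(A)$ as a subset of $F(A)$; and (2) for every relation name of arity $m$ of the output vocabulary there is an MSO query of type $F^m = F \times \cdots \times F$ ($m$ times, again a polynomial functor) defining that relation in $f(A)$. It is linear if all components of $F$ have dimension at most one. A quantifier-free interpretation is an MSO interpretation whose functor is the identity $F(A) = A$ and all of whose formulas are quantifier-free. -}

module Defs where

open import Data.Nat using (ℕ; zero; suc; _+_; _≤_; _<_; _≤ᵇ_; _≡ᵇ_)
open import Data.Bool using (Bool; true; false; not; _∧_; _∨_; if_then_else_)
open import Data.Unit using (⊤; tt)
open import Data.Empty using (⊥)
open import Data.Sum using (_⊎_; inj₁; inj₂; [_,_])
open import Data.Product using (Σ; _×_; _,_; proj₁; proj₂; ∃)
open import Data.Maybe using (Maybe; just; nothing; maybe)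
import Data.Maybe as Maybe
open import Data.Fin using (Fin; toℕ; splitAt)
import Data.Fin as Fin
open import Data.Fin.Properties using (+↔⊎; 1↔⊤; _≟_)
open import Data.List using (List; []; _∷_; length; lookup; allFin; concatMap)
open import Data.Bool.ListAction using (any)
import Data.List as List
open import Data.List.Relation.Unary.All using (All; []; _∷_)
import Data.List.Relation.Unary.All as All
open import Data.Vec using (Vec; []; _∷_; _++_)
import Data.Vec as Vec
open import Data.Vec.Properties using (map-id)
open import Function using (_∘_; id)
open import Function.Bundles using (_↔_; Inverse)
open import Function.Construct.Composition using (_↔-∘_)
open import Function.Properties.Inverse using (↔-refl)
open import Data.Sum.Function.Propositional using (_⊎-↔_)
open import Relation.Binary.PropositionalEquality using (_≡_; refl; cong)
open import Relation.Nullary using (yes; no)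

record Vocab : Set₁ where
  field
    Name   : Set
    arity  : Name → ℕ
    finite : Σ ℕ λ n → Fin n ↔ Name
open Vocab public

record Structure (σ : Vocab) : Set where
  field
    size : ℕ
    rel  : (r : Name σ) → Vec (Fin size) (arity σ r) → Bool
open Structure public

record _≅_ {σ : Vocab} (A B : Structure σ) : Set where
  field
    bij  : Fin (size A) ↔ Fin (size B)
    pres : ∀ (r : Name σ) (xs : Vec (Fin (size A)) (arity σ r)) →
           rel B r (Vec.map (Inverse.to bij) xs) ≡ rel A r xs

≅-refl : {σ : Vocab} {A : Structure σ} → A ≅ A
≅-refl {A = A} = record { bij = ↔-refl ; pres = λ r xs → cong (rel A r) (map-id xs) }

record Class (σ : Vocab) : Set₁ where
  field
    member : Structure σ → Set
    closed : {A B : Structure σ} → A ≅ B → member A → member B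
open Class public

collectL : {m n k : ℕ} → Vec (Fin (m + n)) k → Maybe (Vec (Fin m) k)
collectL [] = just []
collectL {m} (x ∷ xs) with splitAt m x
... | inj₁ y = Maybe.map (y ∷_) (collectL xs)
... | inj₂ _ = nothing

collectR : {m n k : ℕ} → Vec (Fin (m + n)) k → Maybe (Vec (Fin n) k)
collectR [] = just []
collectR {m} (x ∷ xs) with splitAt m x
... | inj₁ _ = nothing
... | inj₂ z = Maybe.map (z ∷_) (collectR xs)

isLeft : {m n : ℕ} → Fin (m + n) → Bool
isLeft {m} x = [ (λ _ → true) , (λ _ → false) ] (splitAt m x)

-- The product construction Σ₁ × Σ₂.
-- Names: (names of Σ₁ ⊎ names of Σ₂) ⊎ ⊤, the ⊤ being the new unary relation
-- selecting the elements of the first component.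

_×v_ : Vocab → Vocab → Vocab
σ₁ ×v σ₂ = record
  { Name   = (Name σ₁ ⊎ Name σ₂) ⊎ ⊤
  ; arity  = [ [ arity σ₁ , arity σ₂ ] , (λ _ → 1) ]
  ; finite = (proj₁ (finite σ₁) + proj₁ (finite σ₂)) + 1
           , (((proj₂ (finite σ₁) ⊎-↔ proj₂ (finite σ₂)) ↔-∘ +↔⊎) ⊎-↔ 1↔⊤) ↔-∘ +↔⊎
  }

_⊗_ : {σ₁ σ₂ : Vocab} → Structure σ₁ → Structure σ₂ → Structure (σ₁ ×v σ₂)
_⊗_ {σ₁} {σ₂} A₁ A₂ = record { size = size A₁ + size A₂ ; rel = R }
  where
    R : (r : Name (σ₁ ×v σ₂)) → Vec (Fin (size A₁ + size A₂)) (arity (σ₁ ×v σ₂) r) → Bool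
    R (inj₁ (inj₁ r)) xs = maybe (rel A₁ r) false (collectL xs)
    R (inj₁ (inj₂ r)) xs = maybe (rel A₂ r) false (collectR {size A₁} xs)
    R (inj₂ tt) (x ∷ []) = isLeft {size A₁} x

_∈×_ : {σ₁ σ₂ : Vocab} → Structure (σ₁ ×v σ₂) → Class σ₁ × Class σ₂ → Set
_∈×_ {σ₁} {σ₂} C (Σ₁ , Σ₂) =
  Σ (Structure σ₁) λ A₁ → Σ (Structure σ₂) λ A₂ →
    member Σ₁ A₁ × member Σ₂ A₂ × (C ≅ (A₁ ⊗ A₂))

-- The list construction Σ*.
-- Names: names of Σ ⊎ ⊤, the ⊤ being the binary order ≤.
-- Nullary relations of Σ become unary.

starArity : ℕ → ℕ
starArity zero    = 1
starArity (suc k) = suc k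

starV : Vocab → Vocab
starV σ = record
  { Name   = Name σ ⊎ ⊤
  ; arity  = [ starArity ∘ arity σ , (λ _ → 2) ]
  ; finite = proj₁ (finite σ) + 1 , (proj₂ (finite σ) ⊎-↔ 1↔⊤) ↔-∘ +↔⊎
  }

module _ {σ : Vocab} where

  total : List (Structure σ) → ℕ
  total []       = 0
  total (A ∷ As) = size A + total As

  locate : (As : List (Structure σ)) → Fin (total As) →
           Σ (Fin (length As)) λ j → Fin (size (lookup As j))
  locate (A ∷ As) x with splitAt (size A) x
  ... | inj₁ y = Fin.zero , y
  ... | inj₂ z with locate As z
  ...   | j , w = Fin.suc j , w

  collectIn : (As : List (Structure σ)) (j : Fin (length As)) {k : ℕ} →
              Vec (Fin (total As)) k → Maybe (Vec (Fin (size (lookup As j))) k)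
  collectIn As j [] = just []
  collectIn As j (x ∷ xs) with locate As x
  ... | j′ , w with j′ ≟ j
  ...   | yes refl = Maybe.map (w ∷_) (collectIn As j xs)
  ...   | no _     = nothing

  starRel : (As : List (Structure σ)) (k : ℕ) →
            ((j : Fin (length As)) → Vec (Fin (size (lookup As j))) k → Bool) →
            Vec (Fin (total As)) (starArity k) → Bool
  starRel As zero    R (x ∷ []) = R (proj₁ (locate As x)) []
  starRel As (suc k) R (x ∷ xs) =
    maybe (R (proj₁ (locate As x))) false (collectIn As (proj₁ (locate As x)) (x ∷ xs))

  listStr : List (Structure σ) → Structure (starV σ)
  listStr As = record { size = total As ; rel = R }
    where
      R : (r : Name (starV σ)) → Vec (Fin (total As)) (arity (starV σ) r) → Bool
      R (inj₁ r) xs = starRel As (arity σ r) (λ j → rel (lookup As j) r) xs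
      R (inj₂ tt) (x ∷ y ∷ []) = toℕ (proj₁ (locate As x)) ≤ᵇ toℕ (proj₁ (locate As y))

_∈*_ : {σ : Vocab} → Structure (starV σ) → Class σ → Set
_∈*_ {σ} A Σc = Σ (List (Structure σ)) λ As →
  All (λ B → (0 < size B) × member Σc B) As × (A ≅ listStr As)

-- MSO formulas with n free first-order and m free set variables.

data Formula (σ : Vocab) (n m : ℕ) : Set where
  rel′  : (r : Name σ) → Vec (Fin n) (arity σ r) → Formula σ n m
  eq′   : Fin n → Fin n → Formula σ n m
  mem′  : Fin n → Fin m → Formula σ n m
  true′ : Formula σ n m
  not′  : Formula σ n m → Formula σ n m
  and′  : Formula σ n m → Formula σ n m → Formula σ n m
  or′   : Formula σ n m → Formula σ n m → Formula σ n m
  ex₁   : Formula σ (suc n) m → Formula σ n m   -- ∃ element (new variable 0)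
  ex₂   : Formula σ n (suc m) → Formula σ n m   -- ∃ set (new set variable 0)

data QF {σ : Vocab} {n m : ℕ} : Formula σ n m → Set where
  rel′  : ∀ r xs → QF (rel′ r xs)
  eq′   : ∀ x y → QF (eq′ x y)
  mem′  : ∀ x X → QF (mem′ x X)
  true′ : QF true′
  not′  : ∀ {φ} → QF φ → QF (not′ φ)
  and′  : ∀ {φ ψ} → QF φ → QF ψ → QF (and′ φ ψ)
  or′   : ∀ {φ ψ} → QF φ → QF ψ → QF (or′ φ ψ)

allSubsets : (k : ℕ) → List (Vec Bool k)
allSubsets zero    = [] ∷ []
allSubsets (suc k) = concatMap (λ v → (false ∷ v) ∷ (true ∷ v) ∷ []) (allSubsets k)

⟦_⟧ : {σ : Vocab} {n m : ℕ} → Formula σ n m → (A : Structure σ) →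
      Vec (Fin (size A)) n → Vec (Vec Bool (size A)) m → Bool
⟦ rel′ r xs ⟧ A ρ S = rel A r (Vec.map (Vec.lookup ρ) xs)
⟦ eq′ x y   ⟧ A ρ S = toℕ (Vec.lookup ρ x) ≡ᵇ toℕ (Vec.lookup ρ y)
⟦ mem′ x X  ⟧ A ρ S = Vec.lookup (Vec.lookup S X) (Vec.lookup ρ x)
⟦ true′     ⟧ A ρ S = true
⟦ not′ φ    ⟧ A ρ S = not (⟦ φ ⟧ A ρ S)
⟦ and′ φ ψ  ⟧ A ρ S = ⟦ φ ⟧ A ρ S ∧ ⟦ ψ ⟧ A ρ S
⟦ or′ φ ψ   ⟧ A ρ S = ⟦ φ ⟧ A ρ S ∨ ⟦ ψ ⟧ A ρ S
⟦ ex₁ φ     ⟧ A ρ S = any (λ a → ⟦ φ ⟧ A (a ∷ ρ) S) (allFin (size A))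
⟦ ex₂ φ     ⟧ A ρ S = any (λ X → ⟦ φ ⟧ A ρ (X ∷ S)) (allSubsets (size A))

-- Polynomial functors F(A) = A^{k₁} + ⋯ + A^{kₙ}, given by the list [k₁,…,kₙ].

PolyFunctor : Set
PolyFunctor = List ℕ

Comp : PolyFunctor → Set
Comp F = Fin (length F)

El : PolyFunctor → ℕ → Set
El F k = Σ (Comp F) λ i → Vec (Fin k) (lookup F i)

-- dimension of the component (i₁,…,i_m) of F^m = F × ⋯ × F
dimTuple : (F : PolyFunctor) {m : ℕ} → Vec (Comp F) m → ℕ
dimTuple F []       = 0
dimTuple F (i ∷ is) = lookup F i + dimTuple F is

flatten : {F : PolyFunctor} {k m : ℕ} (es : Vec (El F k) m) →
          Vec (Fin k) (dimTuple F (Vec.map proj₁ es))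
flatten []             = []
flatten {F} ((i , v) ∷ es) = v ++ flatten {F} es

-- An MSO interpretation with functor F from vocabulary σ to vocabulary τ:
-- an MSO query of type F (universe) and, for each output relation of arity m,
-- an MSO query of type F^m (one formula per component of F^m).
record MSOInterp (σ τ : Vocab) (F : PolyFunctor) : Set where
  field
    univ : (i : Comp F) → Formula σ (lookup F i) 0
    rels : (r : Name τ) (c : Vec (Comp F) (arity τ r)) → Formula σ (dimTuple F c) 0
open MSOInterp public

module _ {σ τ : Vocab} {F : PolyFunctor} (I : MSOInterp σ τ F) (A : Structure σ) where

  inUniv : El F (size A) → Bool
  inUniv (i , v) = ⟦ univ I i ⟧ A v []

  relHolds : (r : Name τ) → Vec (El F (size A)) (arity τ r) → Bool
  relHolds r es = ⟦ rels I r (Vec.map proj₁ es) ⟧ A (flatten {F} es) []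

-- I applied to A produces (a structure isomorphic to) B.
record Produces {σ τ : Vocab} {F : PolyFunctor} (I : MSOInterp σ τ F)
                (A : Structure σ) (B : Structure τ) : Set where
  field
    bij  : Fin (size B) ↔ (Σ (El F (size A)) λ e → inUniv I A e ≡ true)
    pres : ∀ (r : Name τ) (xs : Vec (Fin (size B)) (arity τ r)) →
           rel B r xs ≡ relHolds I A r (Vec.map (proj₁ ∘ Inverse.to bij) xs)

Linear : PolyFunctor → Set
Linear F = All (_≤ 1) F

-- quantifier-free interpretation: functor is the identity (one component of
-- dimension 1) and all formulas are quantifier-free
IsQF : {σ τ : Vocab} → MSOInterp σ τ (1 ∷ []) → Set
IsQF {σ} {τ} I = (∀ i → QF (univ I i)) × (∀ (r : Name τ) c → QF (rels I r c))

module _ {σ γ : Vocab} (Σc : Class σ) (Γc : Class γ)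
         (δ  : (C : Structure (γ ×v σ)) → C ∈× (Γc , Σc) → Structure γ)
         (δ∈ : (C : Structure (γ ×v σ)) (p : C ∈× (Γc , Σc)) → member Γc (δ C p)) where

  foldStep : (B : Structure γ) → member Γc B → (As : List (Structure σ)) →
             All (member Σc) As → Σ (Structure γ) (member Γc)
  foldStep B b []       []       = B , b
  foldStep B b (A ∷ As) (a ∷ as) =
    foldStep (δ (B ⊗ A) (B , A , b , a , ≅-refl)) (δ∈ (B ⊗ A) (B , A , b , a , ≅-refl)) As as

  foldFun : (B₀ : Structure γ) → member Γc B₀ →
            (A : Structure (starV σ)) → A ∈* Σc → Structure γ
  foldFun B₀ b₀ A (As , ps , _) = proj₁ (foldStep B₀ b₀ As (All.map proj₂ ps))

-- Because δ is quantifier-free with the identity functor, every element of Bₙ is an element of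
-- B₀ or of some item Aⱼ that survived all later steps. For a fixed tuple of t such elements,
-- whether they survive and which atoms hold of them is governed by a finite abstract state (one
-- bit per element and per atom over the tuple), and the update of this state at item j depends
-- only on Aⱼ and on where the tracked elements lie relative to j, so it is quantifier-free
-- definable over Σ*. An MSO formula guesses the run of these states as one set of items per bit
-- and checks it locally, item by item. The output universe therefore consists of list elements
-- (one component of dimension 1) and the elements of B₀ (one component of dimension 0 each).

module Submission where

open import Defs
open import Data.Bool using (Bool; true; false; not; _∧_; _∨_)
open import Data.Bool.ListAction using (any)
open import Data.Bool.Properties using (T-≡; ∨-identityʳ)
open import Data.Empty using (⊥; ⊥-elim)
open import Data.Fin as Fin using (Fin; toℕ; _↑ˡ_; _↑ʳ_; splitAt; join)
import Data.Fin.Properties as Finₚ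
open import Data.List as List using (List; []; _∷_; length; lookup; allFin; concatMap)
open import Data.List.Membership.Propositional using (_∈_; find; lose)
open import Data.List.Membership.Propositional.Properties using (∈-allFin; ∈-concatMap⁺; ∈-map⁺; ∈-lookup)
open import Data.List.Relation.Unary.All as All using (All; []; _∷_)
open import Data.List.Relation.Unary.All.Properties using (replicate⁺)
open import Data.List.Relation.Unary.Any as Any using (here; there)
open import Data.List.Relation.Unary.Any.Properties using (any⁺; any⁻; lookup-index)
open import Data.Maybe as Maybe using (Maybe; just; nothing; maybe; maybe′; is-just; _>>=_)
open import Data.Maybe.Properties using (just-injective)
open import Data.Nat as ℕ using (ℕ; zero; suc; _+_; _≤ᵇ_; _<ᵇ_; _≡ᵇ_; _<_; _≤_; s≤s; z≤n)
import Data.Nat.Properties as ℕₚ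
open import Data.Product using (Σ; _×_; _,_; proj₁; proj₂)
open import Data.Sum as Sum using (_⊎_; inj₁; inj₂)
open import Data.Sum.Properties using (inj₂-injective)
open import Data.Unit using (tt)
open import Data.Vec as Vec using (Vec; []; _∷_; _++_)
import Data.Vec.Properties as Vecₚ
open import Function using (_∘_)
open import Function.Bundles using (Inverse; _↔_; mk↔ₛ′; Equivalence)
open import Relation.Nullary using (yes; no; does)
open import Relation.Binary.PropositionalEquality

∧-true⁺ : ∀ {a b} → a ≡ true → b ≡ true → a ∧ b ≡ true
∧-true⁺ refl refl = refl

∧-true⁻ˡ : ∀ a {b} → a ∧ b ≡ true → a ≡ true
∧-true⁻ˡ true _ = refl

∧-true⁻ʳ : ∀ a {b} → a ∧ b ≡ true → b ≡ true
∧-true⁻ʳ true e = e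

not-true⁺ : ∀ {a} → a ≡ false → not a ≡ true
not-true⁺ refl = refl

not-true⁻ : ∀ {a} → not a ≡ true → a ≡ false
not-true⁻ {false} _ = refl

true≢false : ∀ {a} → a ≡ true → a ≢ false
true≢false refl ()

¬true⇒false : ∀ {a} → a ≢ true → a ≡ false
¬true⇒false {true}  h = ⊥-elim (h refl)
¬true⇒false {false} h = refl

true⇔true⇒≡ : ∀ {a b} → (a ≡ true → b ≡ true) → (b ≡ true → a ≡ true) → a ≡ b
true⇔true⇒≡ {true}          f g = sym (f refl)
true⇔true⇒≡ {false} {true}  f g = g refl
true⇔true⇒≡ {false} {false} f g = refl

≡true-irrelevant : ∀ {a : Bool} (p q : a ≡ true) → p ≡ q
≡true-irrelevant refl refl = refl

any-true⁻ : ∀ {A : Set} (p : A → Bool) xs → any p xs ≡ true → Σ A λ x → x ∈ xs × p x ≡ true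
any-true⁻ p xs e with find (any⁻ p xs (Equivalence.from T-≡ e))
... | x , x∈xs , px = x , x∈xs , Equivalence.to T-≡ px

any-true⁺ : ∀ {A : Set} (p : A → Bool) {x} xs → x ∈ xs → p x ≡ true → any p xs ≡ true
any-true⁺ p xs x∈xs px = Equivalence.to T-≡ (any⁺ p (lose x∈xs (Equivalence.from T-≡ px)))

∈-allSubsets : ∀ {k} (v : Vec Bool k) → v ∈ allSubsets k
∈-allSubsets [] = here refl
∈-allSubsets {suc k} (b ∷ v) =
  ∈-concatMap⁺ (λ v → (false ∷ v) ∷ (true ∷ v) ∷ []) (Any.map (λ { refl → head∈ b }) (∈-allSubsets v))
  where
    head∈ : ∀ b → (b ∷ v) ∈ (false ∷ v) ∷ (true ∷ v) ∷ []
    head∈ false = here refl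
    head∈ true  = there (here refl)

allTuples : (t a : ℕ) → List (Vec (Fin t) a)
allTuples t zero    = [] ∷ []
allTuples t (suc a) = concatMap (λ i → List.map (i ∷_) (allTuples t a)) (allFin t)

∈-allTuples : ∀ {t a} (v : Vec (Fin t) a) → v ∈ allTuples t a
∈-allTuples [] = here refl
∈-allTuples {t} {suc a} (i ∷ v) =
  ∈-concatMap⁺ (λ i → List.map (i ∷_) (allTuples t a))
               (Any.map (λ { refl → ∈-map⁺ (i ∷_) (∈-allTuples v) }) (∈-allFin i))

allOf : ∀ {t k} → (Fin t → Bool) → Vec (Fin t) k → Bool
allOf f []       = true
allOf f (i ∷ is) = f i ∧ allOf f is

allOf-cong : ∀ {t k} {f g : Fin t → Bool} → (∀ i → f i ≡ g i) → (w : Vec (Fin t) k) → allOf f w ≡ allOf g w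
allOf-cong h []      = refl
allOf-cong h (i ∷ w) = cong₂ _∧_ (h i) (allOf-cong h w)

module _ {σ : Vocab} where

  false′ : ∀ {n m} → Formula σ n m
  false′ = not′ true′

  const′ : ∀ {n m} → Bool → Formula σ n m
  const′ true  = true′
  const′ false = false′

  imp′ : ∀ {n m} → Formula σ n m → Formula σ n m → Formula σ n m
  imp′ φ ψ = or′ (not′ φ) ψ

  iff′ : ∀ {n m} → Formula σ n m → Formula σ n m → Formula σ n m
  iff′ φ ψ = or′ (and′ φ ψ) (and′ (not′ φ) (not′ ψ))

  all₁ : ∀ {n m} → Formula σ (suc n) m → Formula σ n m
  all₁ φ = not′ (ex₁ (not′ φ))

  forAllFin′ : ∀ {n m} (k : ℕ) → (Fin k → Formula σ n m) → Formula σ n m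
  forAllFin′ zero    f = true′
  forAllFin′ (suc k) f = and′ (f Fin.zero) (forAllFin′ k (f ∘ Fin.suc))

  allOf′ : ∀ {t n m k} → (Fin t → Formula σ n m) → Vec (Fin t) k → Formula σ n m
  allOf′ f []       = true′
  allOf′ f (i ∷ is) = and′ (f i) (allOf′ f is)

  exSets : ∀ {n m} (k : ℕ) → Formula σ n (k + m) → Formula σ n m
  exSets zero    φ = φ
  exSets (suc k) φ = exSets k (ex₂ φ)

  module _ (A : Structure σ) {n m : ℕ} (ρ : Vec (Fin (size A)) n) (S : Vec (Vec Bool (size A)) m) where

    ⟦const′⟧ : ∀ b → ⟦ const′ b ⟧ A ρ S ≡ b
    ⟦const′⟧ true  = refl
    ⟦const′⟧ false = refl

    ⟦iff′⟧⁻ : (φ ψ : Formula σ n m) → ⟦ iff′ φ ψ ⟧ A ρ S ≡ true → ⟦ φ ⟧ A ρ S ≡ ⟦ ψ ⟧ A ρ S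
    ⟦iff′⟧⁻ φ ψ e with ⟦ φ ⟧ A ρ S | ⟦ ψ ⟧ A ρ S
    ... | true  | true  = refl
    ... | false | false = refl

    ⟦iff′⟧⁺ : (φ ψ : Formula σ n m) → ⟦ φ ⟧ A ρ S ≡ ⟦ ψ ⟧ A ρ S → ⟦ iff′ φ ψ ⟧ A ρ S ≡ true
    ⟦iff′⟧⁺ φ ψ e with ⟦ φ ⟧ A ρ S | ⟦ ψ ⟧ A ρ S
    ⟦iff′⟧⁺ φ ψ refl | true  | true  = refl
    ⟦iff′⟧⁺ φ ψ refl | false | false = refl

    ⟦imp′⟧⁻ : (φ ψ : Formula σ n m) → ⟦ imp′ φ ψ ⟧ A ρ S ≡ true → ⟦ φ ⟧ A ρ S ≡ true → ⟦ ψ ⟧ A ρ S ≡ true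
    ⟦imp′⟧⁻ φ ψ e h rewrite h = e

    ⟦imp′⟧⁺ : (φ ψ : Formula σ n m) → (⟦ φ ⟧ A ρ S ≡ true → ⟦ ψ ⟧ A ρ S ≡ true) → ⟦ imp′ φ ψ ⟧ A ρ S ≡ true
    ⟦imp′⟧⁺ φ ψ h with ⟦ φ ⟧ A ρ S
    ... | true  = h refl
    ... | false = refl

    ⟦ex₁⟧⁻ : (φ : Formula σ (suc n) m) → ⟦ ex₁ φ ⟧ A ρ S ≡ true → Σ (Fin (size A)) λ a → ⟦ φ ⟧ A (a ∷ ρ) S ≡ true
    ⟦ex₁⟧⁻ φ e with any-true⁻ (λ a → ⟦ φ ⟧ A (a ∷ ρ) S) (allFin (size A)) e
    ... | a , _ , h = a , h

    ⟦ex₁⟧⁺ : (φ : Formula σ (suc n) m) (a : Fin (size A)) → ⟦ φ ⟧ A (a ∷ ρ) S ≡ true → ⟦ ex₁ φ ⟧ A ρ S ≡ true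
    ⟦ex₁⟧⁺ φ a = any-true⁺ (λ a → ⟦ φ ⟧ A (a ∷ ρ) S) (allFin (size A)) (∈-allFin a)

    ⟦all₁⟧⁻ : (φ : Formula σ (suc n) m) → ⟦ all₁ φ ⟧ A ρ S ≡ true → ∀ a → ⟦ φ ⟧ A (a ∷ ρ) S ≡ true
    ⟦all₁⟧⁻ φ e a with ⟦ φ ⟧ A (a ∷ ρ) S in eq
    ... | true  = refl
    ... | false = ⊥-elim (true≢false (⟦ex₁⟧⁺ (not′ φ) a (not-true⁺ eq)) (not-true⁻ e))

    ⟦all₁⟧⁺ : (φ : Formula σ (suc n) m) → (∀ a → ⟦ φ ⟧ A (a ∷ ρ) S ≡ true) → ⟦ all₁ φ ⟧ A ρ S ≡ true
    ⟦all₁⟧⁺ φ h = not-true⁺ (¬true⇒false λ e →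
      let a , ¬φa = ⟦ex₁⟧⁻ (not′ φ) e in true≢false (h a) (not-true⁻ ¬φa))

    ⟦forAllFin′⟧⁻ : ∀ k (f : Fin k → Formula σ n m) → ⟦ forAllFin′ k f ⟧ A ρ S ≡ true → ∀ i → ⟦ f i ⟧ A ρ S ≡ true
    ⟦forAllFin′⟧⁻ (suc k) f e Fin.zero    = ∧-true⁻ˡ _ e
    ⟦forAllFin′⟧⁻ (suc k) f e (Fin.suc i) = ⟦forAllFin′⟧⁻ k (f ∘ Fin.suc) (∧-true⁻ʳ _ e) i

    ⟦forAllFin′⟧⁺ : ∀ k (f : Fin k → Formula σ n m) → (∀ i → ⟦ f i ⟧ A ρ S ≡ true) → ⟦ forAllFin′ k f ⟧ A ρ S ≡ true
    ⟦forAllFin′⟧⁺ zero    f h = refl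
    ⟦forAllFin′⟧⁺ (suc k) f h = ∧-true⁺ (h Fin.zero) (⟦forAllFin′⟧⁺ k (f ∘ Fin.suc) (h ∘ Fin.suc))

    ⟦allOf′⟧ : ∀ {t k} (f : Fin t → Formula σ n m) (g : Fin t → Bool) → (∀ i → ⟦ f i ⟧ A ρ S ≡ g i) →
               (w : Vec (Fin t) k) → ⟦ allOf′ f w ⟧ A ρ S ≡ allOf g w
    ⟦allOf′⟧ f g h []      = refl
    ⟦allOf′⟧ f g h (i ∷ w) = cong₂ _∧_ (h i) (⟦allOf′⟧ f g h w)

  module _ (A : Structure σ) {n m : ℕ} (ρ : Vec (Fin (size A)) n) where

    ⟦exSets⟧⁻ : ∀ k (φ : Formula σ n (k + m)) S → ⟦ exSets k φ ⟧ A ρ S ≡ true →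
                Σ (Vec (Vec Bool (size A)) k) λ X → ⟦ φ ⟧ A ρ (X ++ S) ≡ true
    ⟦exSets⟧⁻ zero    φ S e = [] , e
    ⟦exSets⟧⁻ (suc k) φ S e with ⟦exSets⟧⁻ k (ex₂ φ) S e
    ... | Xs , h with any-true⁻ (λ X → ⟦ φ ⟧ A ρ (X ∷ Xs ++ S)) (allSubsets (size A)) h
    ...   | X , _ , h′ = X ∷ Xs , h′

    ⟦exSets⟧⁺ : ∀ k (φ : Formula σ n (k + m)) S (X : Vec (Vec Bool (size A)) k) →
                ⟦ φ ⟧ A ρ (X ++ S) ≡ true → ⟦ exSets k φ ⟧ A ρ S ≡ true
    ⟦exSets⟧⁺ zero    φ S []       e = e
    ⟦exSets⟧⁺ (suc k) φ S (X ∷ Xs) e =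
      ⟦exSets⟧⁺ k (ex₂ φ) S Xs (any-true⁺ (λ X → ⟦ φ ⟧ A ρ (X ∷ Xs ++ S)) (allSubsets (size A)) (∈-allSubsets X) e)

<ᵇ-suc : ∀ p q → (p <ᵇ suc q) ≡ (p ≤ᵇ q)
<ᵇ-suc zero    q = refl
<ᵇ-suc (suc p) q = refl

<ᵇ-via-≤ᵇ : ∀ p q → (p ≤ᵇ q) ∧ not (q ≤ᵇ p) ≡ (p <ᵇ q)
<ᵇ-via-≤ᵇ zero    zero    = refl
<ᵇ-via-≤ᵇ zero    (suc q) = refl
<ᵇ-via-≤ᵇ (suc p) zero    = refl
<ᵇ-via-≤ᵇ (suc p) (suc q) rewrite <ᵇ-suc p q | <ᵇ-suc q p = <ᵇ-via-≤ᵇ p q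

≡ᵇ-via-≤ᵇ : ∀ p q → (p ≤ᵇ q) ∧ (q ≤ᵇ p) ≡ (p ≡ᵇ q)
≡ᵇ-via-≤ᵇ zero    zero    = refl
≡ᵇ-via-≤ᵇ zero    (suc q) = refl
≡ᵇ-via-≤ᵇ (suc p) zero    = refl
≡ᵇ-via-≤ᵇ (suc p) (suc q) rewrite <ᵇ-suc p q | <ᵇ-suc q p = ≡ᵇ-via-≤ᵇ p q

<ᵇ⇒< : ∀ {m n} → (m <ᵇ n) ≡ true → m < n
<ᵇ⇒< {m} {n} e = ℕₚ.<ᵇ⇒< m n (Equivalence.from T-≡ e)

<⇒<ᵇ : ∀ {m n} → m < n → (m <ᵇ n) ≡ true
<⇒<ᵇ h = Equivalence.to T-≡ (ℕₚ.<⇒<ᵇ h)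

module _ {σ : Vocab} where

  Position : List (Structure σ) → Set
  Position As = Σ (Fin (length As)) λ j → Fin (size (lookup As j))

  embed : (As : List (Structure σ)) → Position As → Fin (total As)
  embed (A ∷ As) (Fin.zero  , w) = w ↑ˡ total As
  embed (A ∷ As) (Fin.suc j , w) = size A ↑ʳ embed As (j , w)

  embed-locate : (As : List (Structure σ)) (x : Fin (total As)) → embed As (locate As x) ≡ x
  embed-locate (A ∷ As) x with splitAt (size A) x in eq
  ... | inj₁ y = trans (cong (join (size A) (total As)) (sym eq)) (Finₚ.join-splitAt (size A) (total As) x)
  ... | inj₂ z with locate As z | embed-locate As z
  ...   | j , w | ih = trans (cong (size A ↑ʳ_) ih)
                             (trans (cong (join (size A) (total As)) (sym eq)) (Finₚ.join-splitAt (size A) (total As) x))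

  locate-embed : (As : List (Structure σ)) (p : Position As) → locate As (embed As p) ≡ p
  locate-embed (A ∷ As) (Fin.zero , w) rewrite Finₚ.splitAt-↑ˡ (size A) w (total As) = refl
  locate-embed (A ∷ As) (Fin.suc j , w)
    rewrite Finₚ.splitAt-↑ʳ (size A) (total As) (embed As (j , w)) | locate-embed As (j , w) = refl

  collectIn-local : (As : List (Structure σ)) (j : Fin (length As)) {k : ℕ} (xs : Vec (Fin (total As)) k)
    (ws : Vec (Fin (size (lookup As j))) k) → (∀ i → locate As (Vec.lookup xs i) ≡ (j , Vec.lookup ws i)) →
    collectIn As j xs ≡ just ws
  collectIn-local As j []       []       h = refl
  collectIn-local As j (x ∷ xs) (w ∷ ws) h with locate As x | h Fin.zero
  ... | .(j , w) | refl with j Finₚ.≟ j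
  ...   | yes refl rewrite collectIn-local As j xs ws (h ∘ Fin.suc) = refl
  ...   | no j≢j   = ⊥-elim (j≢j refl)

  starRel-local : (As : List (Structure σ)) {a : ℕ}
    (R : (j : Fin (length As)) → Vec (Fin (size (lookup As j))) (suc a) → Bool)
    (j : Fin (length As)) (xs : Vec (Fin (total As)) (suc a)) (ws : Vec (Fin (size (lookup As j))) (suc a)) →
    (∀ l → locate As (Vec.lookup xs l) ≡ (j , Vec.lookup ws l)) → starRel As (suc a) R xs ≡ R j ws
  starRel-local As R j (x ∷ xs) ws h = go (proj₁ (locate As x)) (cong proj₁ (h Fin.zero))
    where
      go : ∀ j′ → j′ ≡ j → maybe (R j′) false (collectIn As j′ (x ∷ xs)) ≡ R j ws
      go .j refl rewrite collectIn-local As j (x ∷ xs) ws h = refl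

  -- The position of an object relative to the list item currently being processed.
  data Kind (A : Structure σ) : Set where
    before : Kind A
    now    : Fin (size A) → Kind A
    later  : Kind A

  isBefore : {A : Structure σ} → Kind A → Bool
  isBefore before = true
  isBefore _      = false

  isNow : {A : Structure σ} → Kind A → Bool
  isNow (now _) = true
  isNow _       = false

  kindAt : (As : List (Structure σ)) (j : Fin (length As)) → Position As → Kind (lookup As j)
  kindAt (A ∷ As) Fin.zero    (Fin.zero   , w) = now w
  kindAt (A ∷ As) Fin.zero    (Fin.suc j′ , w) = later
  kindAt (A ∷ As) (Fin.suc j) (Fin.zero   , w) = before
  kindAt (A ∷ As) (Fin.suc j) (Fin.suc j′ , w) = kindAt As j (j′ , w)

  isNow-kindAt : (As : List (Structure σ)) (j : Fin (length As)) → ∀ p → isNow (kindAt As j p) ≡ (toℕ (proj₁ p) ≡ᵇ toℕ j)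
  isNow-kindAt (A ∷ As) Fin.zero    (Fin.zero   , w) = refl
  isNow-kindAt (A ∷ As) Fin.zero    (Fin.suc j′ , w) = refl
  isNow-kindAt (A ∷ As) (Fin.suc j) (Fin.zero   , w) = refl
  isNow-kindAt (A ∷ As) (Fin.suc j) (Fin.suc j′ , w) = isNow-kindAt As j (j′ , w)

  isBefore-kindAt : (As : List (Structure σ)) (j : Fin (length As)) → ∀ p → isBefore (kindAt As j p) ≡ (toℕ (proj₁ p) <ᵇ toℕ j)
  isBefore-kindAt (A ∷ As) Fin.zero    (Fin.zero   , w) = refl
  isBefore-kindAt (A ∷ As) Fin.zero    (Fin.suc j′ , w) = refl
  isBefore-kindAt (A ∷ As) (Fin.suc j) (Fin.zero   , w) = refl
  isBefore-kindAt (A ∷ As) (Fin.suc j) (Fin.suc j′ , w) = isBefore-kindAt As j (j′ , w)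

  kindAt-now⁻ : (As : List (Structure σ)) (j : Fin (length As)) → ∀ p w → kindAt As j p ≡ now w → p ≡ (j , w)
  kindAt-now⁻ (A ∷ As) Fin.zero    (Fin.zero , w′) w refl = refl
  kindAt-now⁻ (A ∷ As) (Fin.suc j) (Fin.suc j′ , w′) w e with kindAt-now⁻ As j (j′ , w′) w e
  ... | refl = refl

-- Abstract states of tracked elements

idComponents : ∀ {t a} → Vec (Fin t) a → Vec (Fin 1) a
idComponents []      = []
idComponents (_ ∷ w) = Fin.zero ∷ idComponents w

idFlatten : ∀ {t a} (c : Vec (Fin 1) a) → Vec (Fin t) a → Vec (Fin t) (dimTuple (1 ∷ []) c)
idFlatten []             []      = []
idFlatten (Fin.zero ∷ c) (i ∷ w) = i ∷ idFlatten c w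

-- The state after a prefix of the list records which tracked objects are alive
-- and every atomic fact about them: |Bit| depends only on γ and t, not on the list.
module Atoms (γ : Vocab) (t : ℕ) where

  Atom : Set
  Atom = Σ (Name γ) λ r → Vec (Fin t) (arity γ r)

  allNames : List (Name γ)
  allNames = List.map (Inverse.to (proj₂ (finite γ))) (allFin (proj₁ (finite γ)))

  ∈-allNames : (r : Name γ) → r ∈ allNames
  ∈-allNames r = subst (_∈ allNames) (Inverse.strictlyInverseˡ (proj₂ (finite γ)) r)
                       (∈-map⁺ (Inverse.to (proj₂ (finite γ))) (∈-allFin (Inverse.from (proj₂ (finite γ)) r)))

  atoms : List Atom
  atoms = concatMap (λ r → List.map (r ,_) (allTuples t (arity γ r))) allNames

  ∈-atoms : (a : Atom) → a ∈ atoms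
  ∈-atoms (r , w) = ∈-concatMap⁺ (λ r → List.map (r ,_) (allTuples t (arity γ r)))
                                 (Any.map (λ { refl → ∈-map⁺ (r ,_) (∈-allTuples w) }) (∈-allNames r))

  nAtoms : ℕ
  nAtoms = length atoms

  atomIndex : Atom → Fin nAtoms
  atomIndex a = Any.index (∈-atoms a)

  lookup-atomIndex : (a : Atom) → lookup atoms (atomIndex a) ≡ a
  lookup-atomIndex a = sym (lookup-index (∈-atoms a))

  Bit : Set
  Bit = Fin t ⊎ Fin nAtoms

-- sameObject tells which tracked objects denote the same element.
module AbstractStep {σ γ : Vocab} (J : MSOInterp (γ ×v σ) γ (1 ∷ [])) (t : ℕ) (sameObject : Fin t → Fin t → Bool) where
  open Atoms γ t public

  module _ (A : Structure σ) (κ : Fin t → Kind A) where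

    collectNow : ∀ {k} → Vec (Fin t) k → Maybe (Vec (Fin (size A)) k)
    collectNow [] = just []
    collectNow (i ∷ is) with κ i
    ... | now w  = Maybe.map (w ∷_) (collectNow is)
    ... | before = nothing
    ... | later  = nothing

    collectNow-now : ∀ i w₀ {k} (w : Vec (Fin t) k) → κ i ≡ now w₀ → collectNow (i ∷ w) ≡ Maybe.map (w₀ ∷_) (collectNow w)
    collectNow-now i w₀ w e with κ i | e
    ... | .(now w₀) | refl = refl

    collectNow-¬now : ∀ i {k} (w : Vec (Fin t) k) → isNow (κ i) ≡ false → collectNow (i ∷ w) ≡ nothing
    collectNow-¬now i w e with κ i | e
    ... | before | _ = refl
    ... | later  | _ = refl

    -- Only meaningful on quantifier-free formulas: quantifiers are sent to false.
    evalAbstract : (p : Bit → Bool) → ∀ {n} → Formula (γ ×v σ) n 0 → Vec (Fin t) n → Bool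
    evalAbstract p (rel′ (inj₁ (inj₁ r)) zs) env =
      allOf (isBefore ∘ κ) (Vec.map (Vec.lookup env) zs) ∧ p (inj₂ (atomIndex (r , Vec.map (Vec.lookup env) zs)))
    evalAbstract p (rel′ (inj₁ (inj₂ r)) zs) env = maybe (rel A r) false (collectNow (Vec.map (Vec.lookup env) zs))
    evalAbstract p (rel′ (inj₂ tt) (q ∷ [])) env = isBefore (κ (Vec.lookup env q))
    evalAbstract p (eq′ q q′) env = sameObject (Vec.lookup env q) (Vec.lookup env q′)
    evalAbstract p (mem′ _ ()) env
    evalAbstract p true′      env = true
    evalAbstract p (not′ φ)   env = not (evalAbstract p φ env)
    evalAbstract p (and′ φ ψ) env = evalAbstract p φ env ∧ evalAbstract p ψ env
    evalAbstract p (or′ φ ψ)  env = evalAbstract p φ env ∨ evalAbstract p ψ env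
    evalAbstract p (ex₁ φ)    env = false
    evalAbstract p (ex₂ φ)    env = false

    evalAbstract-cong : {p p′ : Bit → Bool} → (∀ b → p b ≡ p′ b) → ∀ {n} (φ : Formula (γ ×v σ) n 0) env →
                        evalAbstract p φ env ≡ evalAbstract p′ φ env
    evalAbstract-cong h (rel′ (inj₁ (inj₁ r)) zs) env = cong (allOf (isBefore ∘ κ) (Vec.map (Vec.lookup env) zs) ∧_) (h _)
    evalAbstract-cong h (rel′ (inj₁ (inj₂ r)) zs) env = refl
    evalAbstract-cong h (rel′ (inj₂ tt) (q ∷ [])) env = refl
    evalAbstract-cong h (eq′ q q′) env = refl
    evalAbstract-cong h (mem′ _ ()) env
    evalAbstract-cong h true′      env = refl
    evalAbstract-cong h (not′ φ)   env = cong not (evalAbstract-cong h φ env)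
    evalAbstract-cong h (and′ φ ψ) env = cong₂ _∧_ (evalAbstract-cong h φ env) (evalAbstract-cong h ψ env)
    evalAbstract-cong h (or′ φ ψ)  env = cong₂ _∨_ (evalAbstract-cong h φ env) (evalAbstract-cong h ψ env)
    evalAbstract-cong h (ex₁ φ)    env = refl
    evalAbstract-cong h (ex₂ φ)    env = refl

    aliveAfter : (p : Bit → Bool) → Fin t → Bool
    aliveAfter p i = ((isBefore (κ i) ∧ p (inj₁ i)) ∨ isNow (κ i)) ∧ evalAbstract p (univ J Fin.zero) (i ∷ [])

    atomAfter : (p : Bit → Bool) → Atom → Bool
    atomAfter p (r , w) = allOf (aliveAfter p) w ∧ evalAbstract p (rels J r (idComponents w)) (idFlatten (idComponents w) w)

    step : (p : Bit → Bool) → Bit → Bool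
    step p (inj₁ i) = aliveAfter p i
    step p (inj₂ k) = atomAfter p (lookup atoms k)

    aliveAfter-cong : {p p′ : Bit → Bool} → (∀ b → p b ≡ p′ b) → ∀ i → aliveAfter p i ≡ aliveAfter p′ i
    aliveAfter-cong h i = cong₂ _∧_ (cong (λ x → (isBefore (κ i) ∧ x) ∨ isNow (κ i)) (h (inj₁ i)))
                                    (evalAbstract-cong h (univ J Fin.zero) (i ∷ []))

    step-cong : {p p′ : Bit → Bool} → (∀ b → p b ≡ p′ b) → ∀ b → step p b ≡ step p′ b
    step-cong h (inj₁ i) = aliveAfter-cong h i
    step-cong h (inj₂ k) with lookup atoms k
    ... | r , w = cong₂ _∧_ (allOf-cong (aliveAfter-cong h) w)
                            (evalAbstract-cong h (rels J r (idComponents w)) (idFlatten (idComponents w) w))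

  Kinds : List (Structure σ) → Set
  Kinds As = (j : Fin (length As)) → Fin t → Kind (lookup As j)

  runFold : (p : Bit → Bool) (As : List (Structure σ)) → Kinds As → Bit → Bool
  runFold p []       κs = p
  runFold p (A ∷ As) κs = runFold (step A (κs Fin.zero) p) As (κs ∘ Fin.suc)

  runFold-cong : {p p′ : Bit → Bool} → (∀ b → p b ≡ p′ b) → ∀ As κs b → runFold p As κs b ≡ runFold p′ As κs b
  runFold-cong h []       κs b = h b
  runFold-cong h (A ∷ As) κs b = runFold-cong (step-cong A (κs Fin.zero) h) As (κs ∘ Fin.suc) b

  runFold-empty : ∀ p As κs → length As ≡ 0 → ∀ b → runFold p As κs b ≡ p b
  runFold-empty p [] κs e b = refl

  -- the state after processing the items up to and including item j
  runUntil : (p : Bit → Bool) (As : List (Structure σ)) → Kinds As → Fin (length As) → Bit → Bool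
  runUntil p (A ∷ As) κs Fin.zero    = step A (κs Fin.zero) p
  runUntil p (A ∷ As) κs (Fin.suc j) = runUntil (step A (κs Fin.zero) p) As (κs ∘ Fin.suc) j

  runUntil-first : ∀ p As κs (j : Fin (length As)) → toℕ j ≡ 0 → ∀ b →
                   runUntil p As κs j b ≡ step (lookup As j) (κs j) p b
  runUntil-first p (A ∷ As) κs Fin.zero e b = refl

  runUntil-next : ∀ p As κs (j j′ : Fin (length As)) → toℕ j′ ≡ suc (toℕ j) → ∀ b →
                  runUntil p As κs j′ b ≡ step (lookup As j′) (κs j′) (runUntil p As κs j) b
  runUntil-next p (A ∷ A′ ∷ As) κs Fin.zero    (Fin.suc Fin.zero) e b = refl
  runUntil-next p (A ∷ As)      κs (Fin.suc j) (Fin.suc j′)       e b =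
    runUntil-next (step A (κs Fin.zero) p) As (κs ∘ Fin.suc) j j′ (ℕₚ.suc-injective e) b

  runUntil-last : ∀ p As κs (j : Fin (length As)) → suc (toℕ j) ≡ length As → ∀ b → runFold p As κs b ≡ runUntil p As κs j b
  runUntil-last p (A ∷ [])      κs Fin.zero    e b = refl
  runUntil-last p (A ∷ A′ ∷ As) κs (Fin.suc j) e b =
    runUntil-last (step A (κs Fin.zero) p) (A′ ∷ As) (κs ∘ Fin.suc) j (ℕₚ.suc-injective e) b

-- Tracking elements through the fold

allJust : ∀ {X : Set} {k} → Vec (Maybe X) k → Maybe (Vec X k)
allJust []             = just []
allJust (nothing ∷ vs) = nothing
allJust (just x ∷ vs)  = Maybe.map (x ∷_) (allJust vs)

allJust-lookup : ∀ {X : Set} {k} (vs : Vec (Maybe X) k) xs → allJust vs ≡ just xs → ∀ l → Vec.lookup vs l ≡ just (Vec.lookup xs l)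
allJust-lookup (just x ∷ vs) xs e l with allJust vs in eq
allJust-lookup (just x ∷ vs) .(x ∷ xs′) refl Fin.zero    | just xs′ = refl
allJust-lookup (just x ∷ vs) .(x ∷ xs′) refl (Fin.suc l) | just xs′ = allJust-lookup vs xs′ eq l

allJust-tabulate : ∀ {X : Set} {m} (f : Fin m → Maybe X) (xs : Vec X m) → (∀ i → f i ≡ just (Vec.lookup xs i)) →
                   allJust (Vec.map f (Vec.allFin m)) ≡ just xs
allJust-tabulate {X} {m} f xs h =
  trans (cong allJust (trans (Vecₚ.map-cong h (Vec.allFin m))
                      (trans (Vecₚ.map-∘ just (Vec.lookup xs) (Vec.allFin m)) (cong (Vec.map just) (Vecₚ.map-lookup-allFin xs)))))
        (allJust-map-just xs)
  where
    allJust-map-just : ∀ {k} (ys : Vec X k) → allJust (Vec.map just ys) ≡ just ys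
    allJust-map-just []       = refl
    allJust-map-just (y ∷ ys) rewrite allJust-map-just ys = refl

allOf-is-just : ∀ {X : Set} {t k} (f : Fin t → Maybe X) (w : Vec (Fin t) k) →
                allOf (is-just ∘ f) w ≡ is-just (allJust (Vec.map f w))
allOf-is-just f []      = refl
allOf-is-just f (i ∷ w) with f i
... | nothing = refl
... | just x rewrite allOf-is-just f w with allJust (Vec.map f w)
...   | just _  = refl
...   | nothing = refl

map-just⁻ : ∀ {X Y : Set} (f : X → Y) (m : Maybe X) y → Maybe.map f m ≡ just y → Σ X λ x → m ≡ just x × f x ≡ y
map-just⁻ f (just x) y refl = x , refl , refl

>>=-just⁻ : ∀ {X Y : Set} (m : Maybe X) (f : X → Maybe Y) y → (m >>= f) ≡ just y → Σ X λ x → m ≡ just x × f x ≡ just y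
>>=-just⁻ (just x) f y e = x , refl , e

guard : ∀ {X : Set} → Bool → Maybe X → Maybe X
guard true  m = m
guard false m = nothing

map-guard : ∀ {X Y : Set} (f : X → Y) g (m : Maybe X) → Maybe.map f (guard g m) ≡ guard g (Maybe.map f m)
map-guard f true  m = refl
map-guard f false m = refl

maybe-guard : ∀ {X : Set} (f : X → Bool) g (m : Maybe X) → maybe f false (guard g m) ≡ g ∧ maybe f false m
maybe-guard f true  m = refl
maybe-guard f false m = refl

headEl : ∀ {k} → El (1 ∷ []) k → Fin k
headEl (Fin.zero , x ∷ []) = x

mkEl : ∀ {k} → Fin k → El (1 ∷ []) k
mkEl x = Fin.zero , x ∷ []

idComponents-unique : ∀ {a} (c c′ : Vec (Fin 1) a) → c ≡ c′
idComponents-unique []             []               = refl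
idComponents-unique (Fin.zero ∷ c) (Fin.zero ∷ c′) = cong (Fin.zero ∷_) (idComponents-unique c c′)

flatten-related : ∀ {t k a} (R : Fin t → Fin k → Set) (es : Vec (El (1 ∷ []) k) a) (w : Vec (Fin t) a) →
  (∀ l → R (Vec.lookup w l) (headEl (Vec.lookup es l))) →
  ∀ q → R (Vec.lookup (idFlatten (Vec.map proj₁ es) w) q) (Vec.lookup (flatten {1 ∷ []} es) q)
flatten-related R ((Fin.zero , x ∷ []) ∷ es) (i ∷ w) h Fin.zero    = h Fin.zero
flatten-related R ((Fin.zero , x ∷ []) ∷ es) (i ∷ w) h (Fin.suc q) = flatten-related R es w (h ∘ Fin.suc) q

-- The concrete state of B: which tracked elements lie in B, and which atoms over them hold.
module Observation (γ : Vocab) (t : ℕ) where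
  open Atoms γ t

  atomHolds : (B : Structure γ) → (Fin t → Maybe (Fin (size B))) → Atom → Bool
  atomHolds B el (r , w) = maybe (rel B r) false (allJust (Vec.map el w))

  observe : (B : Structure γ) → (Fin t → Maybe (Fin (size B))) → Bit → Bool
  observe B el (inj₁ i) = is-just (el i)
  observe B el (inj₂ k) = atomHolds B el (lookup atoms k)

  observe-cong : (B : Structure γ) {el el′ : Fin t → Maybe (Fin (size B))} → (∀ i → el i ≡ el′ i) → ∀ b →
                 observe B el b ≡ observe B el′ b
  observe-cong B h (inj₁ i) = cong is-just (h i)
  observe-cong B h (inj₂ k) with lookup atoms k
  ... | r , w = cong (λ m → maybe (rel B r) false (allJust m)) (Vecₚ.map-cong h w)

  observe-atom : (B : Structure γ) (el : Fin t → Maybe (Fin (size B))) (a : Atom) →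
                 observe B el (inj₂ (atomIndex a)) ≡ atomHolds B el a
  observe-atom B el a = cong (atomHolds B el) (lookup-atomIndex a)

module Tracking {σ γ : Vocab} (Σc : Class σ) (Γc : Class γ)
    (δ : (C : Structure (γ ×v σ)) → C ∈× (Γc , Σc) → Structure γ)
    (δ∈ : (C : Structure (γ ×v σ)) (p : C ∈× (Γc , Σc)) → member Γc (δ C p))
    (J : MSOInterp (γ ×v σ) γ (1 ∷ []))
    (J-δ : ∀ (C : Structure (γ ×v σ)) (p : C ∈× (Γc , Σc)) → Produces J C (δ C p)) where

  Origin : Structure γ → List (Structure σ) → Set
  Origin B As = Fin (size B) ⊎ Position As

  -- a tracked object: dead (nothing), an element of the current structure, or a position yet to be read
  currentElement : ∀ {B As} → Maybe (Origin B As) → Maybe (Fin (size B))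
  currentElement (just (inj₁ b)) = just b
  currentElement _               = nothing

  is-just-currentElement-map : ∀ {B As} (m : Maybe (Fin (size B))) → is-just (currentElement {B} {As} (Maybe.map inj₁ m)) ≡ is-just m
  is-just-currentElement-map nothing  = refl
  is-just-currentElement-map (just _) = refl

  pendingPosition : ∀ {B As} → Maybe (Origin B As) → Maybe (Position As)
  pendingPosition (just (inj₂ p)) = just p
  pendingPosition _               = nothing

  kindsOf : ∀ {t} (As : List (Structure σ)) → (Fin t → Maybe (Position As)) → (j : Fin (length As)) → Fin t → Kind (lookup As j)
  kindsOf As π j i = maybe′ (kindAt As j) before (π i)

  module Step (B : Structure γ) (b : member Γc B) (A : Structure σ) (a : member Σc A) where

    C : Structure (γ ×v σ)
    C = B ⊗ A

    C∈ : C ∈× (Γc , Σc)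
    C∈ = B , A , b , a , ≅-refl

    B′ : Structure γ
    B′ = δ C C∈

    b′ : member Γc B′
    b′ = δ∈ C C∈

    bij : Fin (size B′) ↔ (Σ (El (1 ∷ []) (size C)) λ e → inUniv J C e ≡ true)
    bij = Produces.bij (J-δ C C∈)

    imageIf : (x : Fin (size C)) (u : Bool) → inUniv J C (mkEl x) ≡ u → Maybe (Fin (size B′))
    imageIf x true  e = just (Inverse.from bij (mkEl x , e))
    imageIf x false e = nothing

    image : Fin (size C) → Maybe (Fin (size B′))
    image x = imageIf x (inUniv J C (mkEl x)) refl

    imageIf-origin : ∀ x u e b₁ → imageIf x u e ≡ just b₁ → headEl (proj₁ (Inverse.to bij b₁)) ≡ x
    imageIf-origin x true e b₁ refl = cong (headEl ∘ proj₁) (Inverse.strictlyInverseˡ bij (mkEl x , e))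

    is-just-image : ∀ x → is-just (image x) ≡ inUniv J C (mkEl x)
    is-just-image x = is-just-imageIf (inUniv J C (mkEl x)) refl
      where
        is-just-imageIf : ∀ u e → is-just (imageIf x u e) ≡ u
        is-just-imageIf true  e = refl
        is-just-imageIf false e = refl

    image-origin : ∀ y → image (headEl (proj₁ (Inverse.to bij y))) ≡ just y
    image-origin y with Inverse.to bij y in eq
    ... | (Fin.zero , x ∷ []) , e = trans (imageIf-true _ refl e) (cong just from-to)
      where
        imageIf-true : ∀ u (e : inUniv J C (mkEl x) ≡ u) (e′ : inUniv J C (mkEl x) ≡ true) →
                       imageIf x u e ≡ just (Inverse.from bij (mkEl x , e′))
        imageIf-true true  e e′ = cong (λ z → just (Inverse.from bij (mkEl x , z))) (≡true-irrelevant e e′)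
        imageIf-true false e e′ = ⊥-elim (true≢false e′ e)
        from-to : Inverse.from bij (mkEl x , e) ≡ y
        from-to = trans (cong (Inverse.from bij) (sym eq)) (Inverse.strictlyInverseʳ bij y)

    module Advance (As : List (Structure σ)) where

      advance : Origin B (A ∷ As) → Maybe (Origin B′ As)
      advance (inj₁ y)               = Maybe.map inj₁ (image (y ↑ˡ size A))
      advance (inj₂ (Fin.zero , w))  = Maybe.map inj₁ (image (size B ↑ʳ w))
      advance (inj₂ (Fin.suc j , w)) = just (inj₂ (j , w))

      originInC : Fin (size B) ⊎ Fin (size A) → Origin B (A ∷ As)
      originInC (inj₁ y) = inj₁ y
      originInC (inj₂ w) = inj₂ (Fin.zero , w)

      unsplit : Fin (size C) → Origin B (A ∷ As)
      unsplit x = originInC (splitAt (size B) x)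

      retreat : Origin B′ As → Origin B (A ∷ As)
      retreat (inj₁ y)       = unsplit (headEl (proj₁ (Inverse.to bij y)))
      retreat (inj₂ (j , w)) = inj₂ (Fin.suc j , w)

      advance-unsplit : ∀ x → advance (unsplit x) ≡ Maybe.map inj₁ (image x)
      advance-unsplit x with splitAt (size B) x in eq
      ... | inj₁ z = cong (Maybe.map inj₁ ∘ image) (Finₚ.splitAt⁻¹-↑ˡ eq)
      ... | inj₂ z = cong (Maybe.map inj₁ ∘ image) (Finₚ.splitAt⁻¹-↑ʳ eq)

      retreat-advance : ∀ o o′ → advance o ≡ just o′ → retreat o′ ≡ o
      retreat-advance (inj₁ y) o′ e with map-just⁻ inj₁ (image (y ↑ˡ size A)) o′ e
      ... | b₁ , e₁ , refl rewrite imageIf-origin (y ↑ˡ size A) _ refl b₁ e₁ | Finₚ.splitAt-↑ˡ (size B) y (size A) = refl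
      retreat-advance (inj₂ (Fin.zero , w)) o′ e with map-just⁻ inj₁ (image (size B ↑ʳ w)) o′ e
      ... | b₁ , e₁ , refl rewrite imageIf-origin (size B ↑ʳ w) _ refl b₁ e₁ | Finₚ.splitAt-↑ʳ (size B) (size A) w = refl
      retreat-advance (inj₂ (Fin.suc j , w)) .(inj₂ (j , w)) refl = refl

      advance-retreat : ∀ o′ → advance (retreat o′) ≡ just o′
      advance-retreat (inj₁ y)       = trans (advance-unsplit _) (cong (Maybe.map inj₁) (image-origin y))
      advance-retreat (inj₂ (j , w)) = refl

      Represents : Maybe (Origin B (A ∷ As)) → Fin (size C) → Set
      Represents (just (inj₁ y))              x = x ≡ y ↑ˡ size A
      Represents (just (inj₂ (Fin.zero , w))) x = x ≡ size B ↑ʳ w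
      Represents _                            _ = ⊥

      Represents-unsplit : ∀ m x → Represents m x → Σ (Origin B (A ∷ As)) λ s → m ≡ just s × unsplit x ≡ s
      Represents-unsplit (just (inj₁ y)) x refl =
        inj₁ y , refl , cong originInC (Finₚ.splitAt-↑ˡ (size B) y (size A))
      Represents-unsplit (just (inj₂ (Fin.zero , w))) x refl =
        inj₂ (Fin.zero , w) , refl , cong originInC (Finₚ.splitAt-↑ʳ (size B) (size A) w)

      Represents-functional : ∀ s x x′ → Represents (just s) x → Represents (just s) x′ → x ≡ x′
      Represents-functional (inj₁ y)              x x′ refl refl = refl
      Represents-functional (inj₂ (Fin.zero , w)) x x′ refl refl = refl

      Represents-advance : ∀ o b₁ → advance o ≡ just (inj₁ b₁) → Represents (just o) (headEl (proj₁ (Inverse.to bij b₁)))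
      Represents-advance (inj₁ y) b₁ e with map-just⁻ inj₁ (image (y ↑ˡ size A)) (inj₁ b₁) e
      ... | _ , e₁ , refl = imageIf-origin (y ↑ˡ size A) _ refl b₁ e₁
      Represents-advance (inj₂ (Fin.zero , w)) b₁ e with map-just⁻ inj₁ (image (size B ↑ʳ w)) (inj₁ b₁) e
      ... | _ , e₁ , refl = imageIf-origin (size B ↑ʳ w) _ refl b₁ e₁

      kindOf : Maybe (Origin B (A ∷ As)) → Kind A
      kindOf (just (inj₂ (Fin.zero , w)))  = now w
      kindOf (just (inj₂ (Fin.suc _ , _))) = later
      kindOf _                             = before

      currentElement-advance : ∀ m b₁ → currentElement {B′} {As} (m >>= advance) ≡ just b₁ →
                               Σ (Origin B (A ∷ As)) λ o → m ≡ just o × advance o ≡ just (inj₁ b₁)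
      currentElement-advance (just o) b₁ e with advance o in eq
      currentElement-advance (just o) b₁ refl | just (inj₁ .b₁) = o , refl , eq

      pendingPosition-image : ∀ (m : Maybe (Fin (size B′))) → pendingPosition {B′} {As} (Maybe.map inj₁ m) ≡ nothing
      pendingPosition-image nothing  = refl
      pendingPosition-image (just _) = refl

      kindsOf-first : ∀ m → maybe′ (kindAt (A ∷ As) Fin.zero) before (pendingPosition {B} {A ∷ As} m) ≡ kindOf m
      kindsOf-first nothing                        = refl
      kindsOf-first (just (inj₁ y))                = refl
      kindsOf-first (just (inj₂ (Fin.zero , w)))  = refl
      kindsOf-first (just (inj₂ (Fin.suc j , w))) = refl

      kindsOf-rest : ∀ m (j : Fin (length As)) →
                     maybe′ (kindAt (A ∷ As) (Fin.suc j)) before (pendingPosition {B} {A ∷ As} m)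
                     ≡ maybe′ (kindAt As j) before (pendingPosition {B′} {As} (m >>= advance))
      kindsOf-rest nothing j = refl
      kindsOf-rest (just (inj₁ y)) j rewrite pendingPosition-image (image (y ↑ˡ size A)) = refl
      kindsOf-rest (just (inj₂ (Fin.zero , w))) j rewrite pendingPosition-image (image (size B ↑ʳ w)) = refl
      kindsOf-rest (just (inj₂ (Fin.suc j′ , w))) j = refl

  foldResult : (B : Structure γ) → member Γc B → (As : List (Structure σ)) → All (member Σc) As → Structure γ
  foldResult B b As as = proj₁ (foldStep Σc Γc δ δ∈ B b As as)

  track : ∀ B b As as → Origin B As → Maybe (Fin (size (foldResult B b As as)))
  track B b []       []       (inj₁ x)       = just x
  track B b []       []       (inj₂ (() , _))
  track B b (A ∷ As) (a ∷ as) o = Step.Advance.advance B b A a As o >>= track (Step.B′ B b A a) (Step.b′ B b A a) As as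

  origin : ∀ B b As as → Fin (size (foldResult B b As as)) → Origin B As
  origin B b []       []       e = inj₁ e
  origin B b (A ∷ As) (a ∷ as) e = Step.Advance.retreat B b A a As (origin (Step.B′ B b A a) (Step.b′ B b A a) As as e)

  track-origin : ∀ B b As as e → track B b As as (origin B b As as e) ≡ just e
  track-origin B b []       []       e = refl
  track-origin B b (A ∷ As) (a ∷ as) e
    rewrite Step.Advance.advance-retreat B b A a As (origin (Step.B′ B b A a) (Step.b′ B b A a) As as e) =
    track-origin (Step.B′ B b A a) (Step.b′ B b A a) As as e

  origin-track : ∀ B b As as o e → track B b As as o ≡ just e → origin B b As as e ≡ o
  origin-track B b []       []       (inj₁ x)       .x refl = refl
  origin-track B b []       []       (inj₂ (() , _)) e h
  origin-track B b (A ∷ As) (a ∷ as) o e h with Step.Advance.advance B b A a As o in eq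
  ... | just o′ = trans (cong (Step.Advance.retreat B b A a As) (origin-track (Step.B′ B b A a) (Step.b′ B b A a) As as o′ e h))
                        (Step.Advance.retreat-advance B b A a As o o′ eq)

-- Soundness of the abstract run

module AbstractRunSound {σ γ : Vocab} (Σc : Class σ) (Γc : Class γ)
    (δ : (C : Structure (γ ×v σ)) → C ∈× (Γc , Σc) → Structure γ)
    (δ∈ : (C : Structure (γ ×v σ)) (p : C ∈× (Γc , Σc)) → member Γc (δ C p))
    (J : MSOInterp (γ ×v σ) γ (1 ∷ [])) (qfJ : IsQF J)
    (J-δ : ∀ (C : Structure (γ ×v σ)) (p : C ∈× (Γc , Σc)) → Produces J C (δ C p))
    (t : ℕ) (sameObject : Fin t → Fin t → Bool) where

  open Tracking Σc Γc δ δ∈ J J-δ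
  open AbstractStep J t sameObject
  open Observation γ t

  Faithful : ∀ {B As} → (Fin t → Maybe (Origin B As)) → Set
  Faithful cur = ∀ i k s s′ → cur i ≡ just s → cur k ≡ just s′ →
                 (sameObject i k ≡ true → s ≡ s′) × (s ≡ s′ → sameObject i k ≡ true)

  module StepSound (B : Structure γ) (b : member Γc B) (A : Structure σ) (a : member Σc A) (As : List (Structure σ))
                   (cur : Fin t → Maybe (Origin B (A ∷ As))) (κ : Fin t → Kind A)
                   (κ-cur : ∀ i → κ i ≡ Step.Advance.kindOf B b A a As (cur i)) (faithful : Faithful {B} {A ∷ As} cur) where
    open Step B b A a
    open Advance As

    state : Bit → Bool
    state = observe B (currentElement {B} {A ∷ As} ∘ cur)

    module _ {n : ℕ} (xs : Vec (Fin (size C)) n) (env : Vec (Fin t) n)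
             (xs-env : ∀ q → Represents (cur (Vec.lookup env q)) (Vec.lookup xs q)) where

      collectL-represented : ∀ {k} (us : Vec (Fin n) k) → collectL {size B} {size A} (Vec.map (Vec.lookup xs) us) ≡
        guard (allOf (isBefore ∘ κ) (Vec.map (Vec.lookup env) us))
              (allJust (Vec.map (currentElement {B} {A ∷ As} ∘ cur) (Vec.map (Vec.lookup env) us)))
      collectL-represented [] = refl
      collectL-represented (u ∷ us) rewrite κ-cur (Vec.lookup env u) with cur (Vec.lookup env u) | xs-env u
      ... | just (inj₁ y) | r rewrite r | Finₚ.splitAt-↑ˡ (size B) y (size A) | collectL-represented us =
            map-guard (y ∷_) (allOf (isBefore ∘ κ) (Vec.map (Vec.lookup env) us)) _
      ... | just (inj₂ (Fin.zero , w)) | r rewrite r | Finₚ.splitAt-↑ʳ (size B) (size A) w = refl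

      collectR-represented : ∀ {k} (us : Vec (Fin n) k) →
        collectR {size B} {size A} (Vec.map (Vec.lookup xs) us) ≡ collectNow A κ (Vec.map (Vec.lookup env) us)
      collectR-represented [] = refl
      collectR-represented (u ∷ us) with κ (Vec.lookup env u) | κ-cur (Vec.lookup env u)
      ... | k | hk with cur (Vec.lookup env u) | xs-env u
      ...   | just (inj₁ y) | r rewrite r | Finₚ.splitAt-↑ˡ (size B) y (size A) | hk = refl
      ...   | just (inj₂ (Fin.zero , w)) | r
              rewrite r | Finₚ.splitAt-↑ʳ (size B) (size A) w | hk | collectR-represented us = refl

      isLeft-represented : ∀ q → isLeft {size B} {size A} (Vec.lookup xs q) ≡ isBefore (κ (Vec.lookup env q))
      isLeft-represented q rewrite κ-cur (Vec.lookup env q) with cur (Vec.lookup env q) | xs-env q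
      ... | just (inj₁ y) | r rewrite r | Finₚ.splitAt-↑ˡ (size B) y (size A) = refl
      ... | just (inj₂ (Fin.zero , w)) | r rewrite r | Finₚ.splitAt-↑ʳ (size B) (size A) w = refl

      ≡ᵇ-represented : ∀ q q′ → (toℕ (Vec.lookup xs q) ≡ᵇ toℕ (Vec.lookup xs q′))
                                ≡ sameObject (Vec.lookup env q) (Vec.lookup env q′)
      ≡ᵇ-represented q q′ with Represents-unsplit _ _ (xs-env q) | Represents-unsplit _ _ (xs-env q′)
      ... | s , cs , us | s′ , cs′ , us′ = true⇔true⇒≡ to from
        where
          to : (toℕ (Vec.lookup xs q) ≡ᵇ toℕ (Vec.lookup xs q′)) ≡ true → sameObject (Vec.lookup env q) (Vec.lookup env q′) ≡ true
          to e = proj₂ (faithful _ _ s s′ cs cs′)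
                   (trans (sym us) (trans (cong unsplit (Finₚ.toℕ-injective (ℕₚ.≡ᵇ⇒≡ _ _ (Equivalence.from T-≡ e)))) us′))
          from : sameObject (Vec.lookup env q) (Vec.lookup env q′) ≡ true → (toℕ (Vec.lookup xs q) ≡ᵇ toℕ (Vec.lookup xs q′)) ≡ true
          from e with proj₁ (faithful _ _ s s′ cs cs′) e
          ... | refl = Equivalence.to T-≡ (ℕₚ.≡⇒≡ᵇ _ _ (cong toℕ (Represents-functional s _ _
                         (subst (λ m → Represents m (Vec.lookup xs q)) cs (xs-env q))
                         (subst (λ m → Represents m (Vec.lookup xs q′)) cs′ (xs-env q′)))))

    -- quantifier-freeness is what makes the evaluation in B ⊗ A depend only on the abstract state
    ⟦⟧≡evalAbstract : ∀ {n} {ψ : Formula (γ ×v σ) n 0} → QF ψ → (xs : Vec (Fin (size C)) n) (env : Vec (Fin t) n) →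
                      (∀ q → Represents (cur (Vec.lookup env q)) (Vec.lookup xs q)) →
                      ⟦ ψ ⟧ C xs [] ≡ evalAbstract A κ state ψ env
    ⟦⟧≡evalAbstract (rel′ (inj₁ (inj₁ r)) zs) xs env H
      rewrite observe-atom B (currentElement {B} {A ∷ As} ∘ cur) (r , Vec.map (Vec.lookup env) zs) | collectL-represented xs env H zs =
      maybe-guard (rel B r) (allOf (isBefore ∘ κ) (Vec.map (Vec.lookup env) zs)) _
    ⟦⟧≡evalAbstract (rel′ (inj₁ (inj₂ r)) zs) xs env H rewrite collectR-represented xs env H zs = refl
    ⟦⟧≡evalAbstract (rel′ (inj₂ tt) (q ∷ [])) xs env H = isLeft-represented xs env H q
    ⟦⟧≡evalAbstract (eq′ q q′) xs env H = ≡ᵇ-represented xs env H q q′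
    ⟦⟧≡evalAbstract (mem′ x ()) xs env H
    ⟦⟧≡evalAbstract true′      xs env H = refl
    ⟦⟧≡evalAbstract (not′ φ)   xs env H = cong not (⟦⟧≡evalAbstract φ xs env H)
    ⟦⟧≡evalAbstract (and′ φ ψ) xs env H = cong₂ _∧_ (⟦⟧≡evalAbstract φ xs env H) (⟦⟧≡evalAbstract ψ xs env H)
    ⟦⟧≡evalAbstract (or′ φ ψ)  xs env H = cong₂ _∨_ (⟦⟧≡evalAbstract φ xs env H) (⟦⟧≡evalAbstract ψ xs env H)

    cur′ : Fin t → Maybe (Origin B′ As)
    cur′ i = cur i >>= advance

    survives : ∀ i x → Represents (cur i) x → evalAbstract A κ state (univ J Fin.zero) (i ∷ []) ≡ is-just (image x)
    survives i x r = trans (sym (⟦⟧≡evalAbstract (proj₁ qfJ Fin.zero) (x ∷ []) (i ∷ []) λ { Fin.zero → r }))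
                           (sym (is-just-image x))

    aliveAfter-sound : ∀ i → aliveAfter A κ state i ≡ is-just (currentElement {B′} {As} (cur′ i))
    aliveAfter-sound i rewrite κ-cur i with cur i in eqc
    ... | nothing                     = refl
    ... | just (inj₂ (Fin.suc j , w)) = refl
    ... | just (inj₁ y)               =
          trans (survives i (y ↑ˡ size A) (subst (λ m → Represents m (y ↑ˡ size A)) (sym eqc) refl))
                (sym (is-just-currentElement-map {B′} {As} (image (y ↑ˡ size A))))
    ... | just (inj₂ (Fin.zero , w))  =
          trans (survives i (size B ↑ʳ w) (subst (λ m → Represents m (size B ↑ʳ w)) (sym eqc) refl))
                (sym (is-just-currentElement-map {B′} {As} (image (size B ↑ʳ w))))

    atomAfter-sound : ∀ (a : Atom) → atomAfter A κ state a ≡ atomHolds B′ (currentElement {B′} {As} ∘ cur′) a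
    atomAfter-sound (r , w)
      rewrite allOf-cong aliveAfter-sound w | allOf-is-just (currentElement {B′} {As} ∘ cur′) w
      with allJust (Vec.map (currentElement {B′} {As} ∘ cur′) w) in eqm
    ... | nothing = refl
    ... | just bs = sym (begin
          rel B′ r bs                                                           ≡⟨ Produces.pres (J-δ C C∈) r bs ⟩
          ⟦ rels J r c ⟧ C (flatten {1 ∷ []} es) []                             ≡⟨ ⟦⟧≡evalAbstract (proj₂ qfJ r c) (flatten {1 ∷ []} es)
                                                                                     (idFlatten c w) represented ⟩
          evalAbstract A κ state (rels J r c) (idFlatten c w)                    ≡⟨ cong (λ c → evalAbstract A κ state (rels J r c) (idFlatten c w))
                                                                                     (idComponents-unique c (idComponents w)) ⟩
          evalAbstract A κ state (rels J r (idComponents w)) (idFlatten (idComponents w) w) ∎)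
      where
        open ≡-Reasoning
        es : Vec (El (1 ∷ []) (size C)) (arity γ r)
        es = Vec.map (proj₁ ∘ Inverse.to bij) bs
        c : Vec (Fin 1) (arity γ r)
        c = Vec.map proj₁ es
        represented-each : ∀ l → Represents (cur (Vec.lookup w l)) (headEl (Vec.lookup es l))
        represented-each l
          with currentElement-advance (cur (Vec.lookup w l)) (Vec.lookup bs l)
                 (trans (sym (Vecₚ.lookup-map l (currentElement {B′} {As} ∘ cur′) w))
                        (allJust-lookup (Vec.map (currentElement {B′} {As} ∘ cur′) w) bs eqm l))
        ... | o , co , so rewrite co | Vecₚ.lookup-map l (proj₁ ∘ Inverse.to bij) bs = Represents-advance o (Vec.lookup bs l) so
        represented : ∀ q → Represents (cur (Vec.lookup (idFlatten c w) q)) (Vec.lookup (flatten {1 ∷ []} es) q)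
        represented = flatten-related (λ i x → Represents (cur i) x) es w represented-each

    step-sound : ∀ bit → step A κ state bit ≡ observe B′ (currentElement {B′} {As} ∘ cur′) bit
    step-sound (inj₁ i) = aliveAfter-sound i
    step-sound (inj₂ k) = atomAfter-sound (lookup atoms k)

    faithful′ : Faithful {B′} {As} cur′
    faithful′ i k s₁ s₂ e₁ e₂ with >>=-just⁻ (cur i) advance s₁ e₁ | >>=-just⁻ (cur k) advance s₂ e₂
    ... | o₁ , c₁ , st₁ | o₂ , c₂ , st₂ =
      (λ eq → just-injective (trans (sym st₁) (trans (cong advance (proj₁ (faithful i k o₁ o₂ c₁ c₂) eq)) st₂))) ,
      (λ eq → proj₂ (faithful i k o₁ o₂ c₁ c₂)
                (trans (sym (retreat-advance o₁ s₁ st₁)) (trans (cong retreat eq) (retreat-advance o₂ s₂ st₂))))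

  observe-fold≡runFold : ∀ B b As as (cur : Fin t → Maybe (Origin B As)) (κs : Kinds As) →
    (∀ j i → κs j i ≡ kindsOf As (pendingPosition {B} {As} ∘ cur) j i) → Faithful {B} {As} cur → ∀ bit →
    observe (foldResult B b As as) (λ i → cur i >>= track B b As as) bit
      ≡ runFold (observe B (currentElement {B} {As} ∘ cur)) As κs bit
  observe-fold≡runFold B b [] [] cur κs κs-cur faithful bit = observe-cong B (λ i → track-nil (cur i)) bit
    where
      track-nil : ∀ m → (m >>= track B b [] []) ≡ currentElement {B} {[]} m
      track-nil nothing                = refl
      track-nil (just (inj₁ x))        = refl
      track-nil (just (inj₂ (() , _)))
  observe-fold≡runFold B b (A ∷ As) (a ∷ as) cur κs κs-cur faithful bit =
    trans (observe-cong (foldResult B b (A ∷ As) (a ∷ as)) (λ i → >>=-assoc (cur i)) bit)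
      (trans (observe-fold≡runFold B′ b′ As as S.cur′ (κs ∘ Fin.suc) κs-cur′ S.faithful′ bit)
             (runFold-cong (sym ∘ S.step-sound) As (κs ∘ Fin.suc) bit))
    where
      open Step B b A a
      κ-cur : ∀ i → κs Fin.zero i ≡ Advance.kindOf As (cur i)
      κ-cur i = trans (κs-cur Fin.zero i) (Advance.kindsOf-first As (cur i))
      module S = StepSound B b A a As cur (κs Fin.zero) κ-cur faithful
      κs-cur′ : ∀ j i → κs (Fin.suc j) i ≡ kindsOf As (pendingPosition {B′} {As} ∘ S.cur′) j i
      κs-cur′ j i = trans (κs-cur (Fin.suc j) i) (Advance.kindsOf-rest As (cur i) j)
      >>=-assoc : ∀ m → (m >>= track B b (A ∷ As) (a ∷ as)) ≡ ((m >>= Advance.advance As) >>= track B′ b′ As as)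
      >>=-assoc nothing  = refl
      >>=-assoc (just o) = refl

module _ {σ : Vocab} where

  ≤′ : ∀ {n m} → Fin n → Fin n → Formula (starV σ) n m
  ≤′ x y = rel′ (inj₂ tt) (x ∷ y ∷ [])

  <′ : ∀ {n m} → Fin n → Fin n → Formula (starV σ) n m
  <′ x y = and′ (≤′ x y) (not′ (≤′ y x))

  first′ : ∀ {n m} → Fin n → Formula (starV σ) n m
  first′ z = not′ (ex₁ (<′ Fin.zero (Fin.suc z)))

  succ′ : ∀ {n m} → Fin n → Fin n → Formula (starV σ) n m
  succ′ y z = and′ (<′ y z) (not′ (ex₁ (and′ (<′ (Fin.suc y) Fin.zero) (<′ Fin.zero (Fin.suc z)))))

  last′ : ∀ {n m} → Fin n → Formula (starV σ) n m
  last′ z = not′ (ex₁ (<′ (Fin.suc z) Fin.zero))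

  module ListOrder (As : List (Structure σ)) (A : Structure (starV σ)) (iso : A ≅ listStr As) where

    toList : Fin (size A) → Fin (total As)
    toList = Inverse.to (_≅_.bij iso)

    fromList : Fin (total As) → Fin (size A)
    fromList = Inverse.from (_≅_.bij iso)

    item : Fin (size A) → Fin (length As)
    item x = proj₁ (locate As (toList x))

    index : Fin (size A) → ℕ
    index x = toℕ (item x)

    index<length : ∀ x → index x < length As
    index<length x = Finₚ.toℕ<n (item x)

    fromList-embed-locate : ∀ x → fromList (embed As (locate As (toList x))) ≡ x
    fromList-embed-locate x = trans (cong fromList (embed-locate As (toList x))) (Inverse.strictlyInverseʳ (_≅_.bij iso) x)

    locate-toList-fromList : ∀ p → locate As (toList (fromList (embed As p))) ≡ p
    locate-toList-fromList p = trans (cong (locate As) (Inverse.strictlyInverseˡ (_≅_.bij iso) (embed As p))) (locate-embed As p)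

    module _ {n m : ℕ} (ρ : Vec (Fin (size A)) n) (S : Vec (Vec Bool (size A)) m) where

      ⟦≤′⟧ : ∀ x y → ⟦ ≤′ x y ⟧ A ρ S ≡ (index (Vec.lookup ρ x) ≤ᵇ index (Vec.lookup ρ y))
      ⟦≤′⟧ x y = sym (_≅_.pres iso (inj₂ tt) (Vec.lookup ρ x ∷ Vec.lookup ρ y ∷ []))

      ⟦<′⟧ : ∀ x y → ⟦ <′ x y ⟧ A ρ S ≡ (index (Vec.lookup ρ x) <ᵇ index (Vec.lookup ρ y))
      ⟦<′⟧ x y rewrite ⟦≤′⟧ x y | ⟦≤′⟧ y x = <ᵇ-via-≤ᵇ (index (Vec.lookup ρ x)) (index (Vec.lookup ρ y))

    module _ (nonempty : All (λ B → 0 < size B) As) where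

      elementAt : (k : ℕ) → k < length As → Σ (Fin (size A)) λ x → index x ≡ k
      elementAt k k<n = fromList (embed As (j , w)) , trans (cong (toℕ ∘ proj₁) (locate-toList-fromList (j , w))) (Finₚ.toℕ-fromℕ< k<n)
        where
          j : Fin (length As)
          j = Fin.fromℕ< k<n
          w : Fin (size (lookup As j))
          w = Fin.fromℕ< (All.lookup nonempty (∈-lookup j))

      elementBefore : ∀ x k → index x ≡ suc k → Σ (Fin (size A)) λ y → index y ≡ k
      elementBefore x k e = elementAt k (ℕₚ.<-trans (ℕₚ.n<1+n k) (subst (_< length As) e (index<length x)))

      lastElement : 0 < length As → Σ (Fin (size A)) λ z → suc (index z) ≡ length As
      lastElement pos with elementAt (ℕ.pred (length As)) (ℕₚ.m≤pred[n]⇒suc[m]≤n ⦃ ℕ.>-nonZero pos ⦄ ℕₚ.≤-refl)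
      ... | z , iz = z , trans (cong suc iz) (ℕₚ.suc-pred (length As) ⦃ ℕ.>-nonZero pos ⦄)

      module _ {n m : ℕ} (ρ : Vec (Fin (size A)) n) (S : Vec (Vec Bool (size A)) m) where

        private
          no-witness : ∀ (φ : Formula (starV σ) (suc n) m) → (∀ x → ⟦ φ ⟧ A (x ∷ ρ) S ≢ true) → ⟦ not′ (ex₁ φ) ⟧ A ρ S ≡ true
          no-witness φ h = not-true⁺ (¬true⇒false λ e → let x , φx = ⟦ex₁⟧⁻ A ρ S φ e in h x φx)

          witness : ∀ (φ : Formula (starV σ) (suc n) m) x → ⟦ φ ⟧ A (x ∷ ρ) S ≡ true → ⟦ not′ (ex₁ φ) ⟧ A ρ S ≢ true
          witness φ x φx e = true≢false (⟦ex₁⟧⁺ A ρ S φ x φx) (not-true⁻ e)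

          ⟦<′⟧-here : ∀ x z → ⟦ <′ Fin.zero (Fin.suc z) ⟧ A (x ∷ ρ) S ≡ true → index x < index (Vec.lookup ρ z)
          ⟦<′⟧-here x z e = <ᵇ⇒< (trans (sym (⟦<′⟧ (x ∷ ρ) S Fin.zero (Fin.suc z))) e)

          ⟦<′⟧-there : ∀ x z → ⟦ <′ (Fin.suc z) Fin.zero ⟧ A (x ∷ ρ) S ≡ true → index (Vec.lookup ρ z) < index x
          ⟦<′⟧-there x z e = <ᵇ⇒< (trans (sym (⟦<′⟧ (x ∷ ρ) S (Fin.suc z) Fin.zero)) e)

          ⟦<′⟧-here⁺ : ∀ x z → index x < index (Vec.lookup ρ z) → ⟦ <′ Fin.zero (Fin.suc z) ⟧ A (x ∷ ρ) S ≡ true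
          ⟦<′⟧-here⁺ x z lt = trans (⟦<′⟧ (x ∷ ρ) S Fin.zero (Fin.suc z)) (<⇒<ᵇ lt)

          ⟦<′⟧-there⁺ : ∀ x z → index (Vec.lookup ρ z) < index x → ⟦ <′ (Fin.suc z) Fin.zero ⟧ A (x ∷ ρ) S ≡ true
          ⟦<′⟧-there⁺ x z lt = trans (⟦<′⟧ (x ∷ ρ) S (Fin.suc z) Fin.zero) (<⇒<ᵇ lt)

        ⟦first′⟧⁻ : ∀ z → ⟦ first′ z ⟧ A ρ S ≡ true → index (Vec.lookup ρ z) ≡ 0
        ⟦first′⟧⁻ z h with index (Vec.lookup ρ z) in e
        ... | zero  = refl
        ... | suc k with elementBefore (Vec.lookup ρ z) k e
        ...   | x , refl = ⊥-elim (witness (<′ Fin.zero (Fin.suc z)) x (⟦<′⟧-here⁺ x z (subst (index x <_) (sym e) (ℕₚ.n<1+n _))) h)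

        ⟦first′⟧⁺ : ∀ z → index (Vec.lookup ρ z) ≡ 0 → ⟦ first′ z ⟧ A ρ S ≡ true
        ⟦first′⟧⁺ z h = no-witness (<′ Fin.zero (Fin.suc z)) λ x e → ℕₚ.n≮0 (subst (index x <_) h (⟦<′⟧-here x z e))

        ⟦succ′⟧⁻ : ∀ y z → ⟦ succ′ y z ⟧ A ρ S ≡ true → index (Vec.lookup ρ z) ≡ suc (index (Vec.lookup ρ y))
        ⟦succ′⟧⁻ y z h with ℕₚ.m≤n⇒m<n∨m≡n (<ᵇ⇒< (trans (sym (⟦<′⟧ ρ S y z)) (∧-true⁻ˡ _ h)))
        ... | inj₂ e  = sym e
        ... | inj₁ lt with elementAt (suc (index (Vec.lookup ρ y))) (ℕₚ.<-trans lt (index<length (Vec.lookup ρ z)))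
        ...   | x , ix = ⊥-elim (witness (and′ (<′ (Fin.suc y) Fin.zero) (<′ Fin.zero (Fin.suc z))) x
                  (∧-true⁺ (⟦<′⟧-there⁺ x y (subst (index (Vec.lookup ρ y) <_) (sym ix) (ℕₚ.n<1+n _)))
                           (⟦<′⟧-here⁺ x z (subst (_< index (Vec.lookup ρ z)) (sym ix) lt)))
                  (∧-true⁻ʳ (⟦ <′ y z ⟧ A ρ S) h))

        ⟦succ′⟧⁺ : ∀ y z → index (Vec.lookup ρ z) ≡ suc (index (Vec.lookup ρ y)) → ⟦ succ′ y z ⟧ A ρ S ≡ true
        ⟦succ′⟧⁺ y z e =
          ∧-true⁺ (trans (⟦<′⟧ ρ S y z) (<⇒<ᵇ (subst (index (Vec.lookup ρ y) <_) (sym e) (ℕₚ.n<1+n _))))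
                  (no-witness (and′ (<′ (Fin.suc y) Fin.zero) (<′ Fin.zero (Fin.suc z))) λ x h →
                     ℕₚ.<⇒≱ (subst (index x <_) e (⟦<′⟧-here x z (∧-true⁻ʳ (⟦ <′ (Fin.suc y) Fin.zero ⟧ A (x ∷ ρ) S) h)))
                            (⟦<′⟧-there x y (∧-true⁻ˡ _ h)))

        ⟦last′⟧⁻ : ∀ z → ⟦ last′ z ⟧ A ρ S ≡ true → suc (index (Vec.lookup ρ z)) ≡ length As
        ⟦last′⟧⁻ z h with ℕₚ.m≤n⇒m<n∨m≡n (index<length (Vec.lookup ρ z))
        ... | inj₂ e  = e
        ... | inj₁ lt with elementAt (suc (index (Vec.lookup ρ z))) lt
        ...   | x , ix = ⊥-elim (witness (<′ (Fin.suc z) Fin.zero) x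
                  (⟦<′⟧-there⁺ x z (subst (index (Vec.lookup ρ z) <_) (sym ix) (ℕₚ.n<1+n _))) h)

        ⟦last′⟧⁺ : ∀ z → suc (index (Vec.lookup ρ z)) ≡ length As → ⟦ last′ z ⟧ A ρ S ≡ true
        ⟦last′⟧⁺ z e = no-witness (<′ (Fin.suc z) Fin.zero) λ x h →
          ℕₚ.<⇒≱ (index<length x) (subst (_≤ index x) e (⟦<′⟧-there x z h))

-- Definability of the step

-- Each of the t tracked objects is either one of the k₀ elements of the initial structure
-- (a constant) or the element named by one of nv free variables.
module StepFormula {σ γ : Vocab} (J : MSOInterp (γ ×v σ) γ (1 ∷ [])) (k₀ t nv : ℕ) (object : Fin t → Fin k₀ ⊎ Fin nv) where
  open Atoms γ t

  collectVars : ∀ {k} → Vec (Fin t) k → Maybe (Vec (Fin nv) k)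
  collectVars [] = just []
  collectVars (i ∷ is) with object i
  ... | inj₁ _ = nothing
  ... | inj₂ v = Maybe.map (v ∷_) (collectVars is)

  sameObject′ : ∀ {n m} → (Fin nv → Fin n) → Fin k₀ ⊎ Fin nv → Fin k₀ ⊎ Fin nv → Formula (starV σ) n m
  sameObject′ var (inj₁ c) (inj₁ c′) = const′ (does (c Finₚ.≟ c′))
  sameObject′ var (inj₂ v) (inj₂ v′) = eq′ (var v) (var v′)
  sameObject′ var _        _         = false′

  -- var locates the free variables among the n variables of the formula; z is the current item.
  module AtItem {n m : ℕ} (var : Fin nv → Fin n) (z : Fin n) where

    before′ : Fin t → Formula (starV σ) n m
    before′ i with object i
    ... | inj₁ _ = true′
    ... | inj₂ v = <′ (var v) z

    now′ : Fin t → Formula (starV σ) n m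
    now′ i with object i
    ... | inj₁ _ = false′
    ... | inj₂ v = and′ (≤′ (var v) z) (≤′ z (var v))

    itemRel′ : (a : ℕ) → (Vec (Fin n) (starArity a) → Formula (starV σ) n m) → Vec (Fin t) a → Formula (starV σ) n m
    itemRel′ zero    R w = R (z ∷ [])
    itemRel′ (suc a) R w = maybe′ (λ vs → and′ (allOf′ now′ w) (R (Vec.map var vs))) false′ (collectVars w)

    module _ (prev : Bit → Formula (starV σ) n m) where

      translate : ∀ {k} → Formula (γ ×v σ) k 0 → Vec (Fin t) k → Formula (starV σ) n m
      translate (rel′ (inj₁ (inj₁ r)) zs) env =
        and′ (allOf′ before′ (Vec.map (Vec.lookup env) zs)) (prev (inj₂ (atomIndex (r , Vec.map (Vec.lookup env) zs))))
      translate (rel′ (inj₁ (inj₂ r)) zs) env = itemRel′ (arity σ r) (rel′ (inj₁ r)) (Vec.map (Vec.lookup env) zs)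
      translate (rel′ (inj₂ tt) (q ∷ [])) env = before′ (Vec.lookup env q)
      translate (eq′ q q′) env = sameObject′ var (object (Vec.lookup env q)) (object (Vec.lookup env q′))
      translate (mem′ _ ()) env
      translate true′      env = true′
      translate (not′ φ)   env = not′ (translate φ env)
      translate (and′ φ ψ) env = and′ (translate φ env) (translate ψ env)
      translate (or′ φ ψ)  env = or′ (translate φ env) (translate ψ env)
      translate (ex₁ φ)    env = false′
      translate (ex₂ φ)    env = false′

      aliveAfter′ : Fin t → Formula (starV σ) n m
      aliveAfter′ i = and′ (or′ (and′ (before′ i) (prev (inj₁ i))) (now′ i)) (translate (univ J Fin.zero) (i ∷ []))

      atomAfter′ : Atom → Formula (starV σ) n m
      atomAfter′ (r , w) = and′ (allOf′ aliveAfter′ w) (translate (rels J r (idComponents w)) (idFlatten (idComponents w) w))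

      step′ : Bit → Formula (starV σ) n m
      step′ (inj₁ i) = aliveAfter′ i
      step′ (inj₂ k) = atomAfter′ (lookup atoms k)

  module Sound (As : List (Structure σ)) (A : Structure (starV σ)) (iso : A ≅ listStr As) (X : Fin nv → Fin (size A)) where
    open ListOrder As A iso

    objectPosition : Fin k₀ ⊎ Fin nv → Maybe (Position As)
    objectPosition (inj₁ _) = nothing
    objectPosition (inj₂ v) = just (locate As (toList (X v)))

    kinds : (j : Fin (length As)) → Fin t → Kind (lookup As j)
    kinds j i = maybe′ (kindAt As j) before (objectPosition (object i))

    sameObjectᵇ : Fin k₀ ⊎ Fin nv → Fin k₀ ⊎ Fin nv → Bool
    sameObjectᵇ (inj₁ c) (inj₁ c′) = does (c Finₚ.≟ c′)
    sameObjectᵇ (inj₂ v) (inj₂ v′) = toℕ (X v) ≡ᵇ toℕ (X v′)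
    sameObjectᵇ _        _         = false

    sameObject : Fin t → Fin t → Bool
    sameObject i k = sameObjectᵇ (object i) (object k)

    open AbstractStep J t sameObject using (collectNow; collectNow-now; collectNow-¬now; evalAbstract; aliveAfter; step)

    module _ {n m : ℕ} (ρ : Vec (Fin (size A)) n) (S : Vec (Vec Bool (size A)) m) (var : Fin nv → Fin n) (z : Fin n)
             (ρ-var : ∀ v → Vec.lookup ρ (var v) ≡ X v) (j : Fin (length As)) (z-j : item (Vec.lookup ρ z) ≡ j) where
      open AtItem {n} {m} var z

      ⟦before′⟧ : ∀ i → ⟦ before′ i ⟧ A ρ S ≡ isBefore (kinds j i)
      ⟦before′⟧ i with object i
      ... | inj₁ _ = refl
      ... | inj₂ v rewrite ⟦<′⟧ ρ S (var v) z | z-j | ρ-var v = sym (isBefore-kindAt As j _)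

      ⟦now′⟧ : ∀ i → ⟦ now′ i ⟧ A ρ S ≡ isNow (kinds j i)
      ⟦now′⟧ i with object i
      ... | inj₁ _ = refl
      ... | inj₂ v rewrite ⟦≤′⟧ ρ S (var v) z | ⟦≤′⟧ ρ S z (var v) | z-j | ρ-var v =
            trans (≡ᵇ-via-≤ᵇ (index (X v)) (toℕ j)) (sym (isNow-kindAt As j _))

      ⟦sameObject′⟧ : ∀ u u′ → ⟦ sameObject′ {n} {m} var u u′ ⟧ A ρ S ≡ sameObjectᵇ u u′
      ⟦sameObject′⟧ (inj₁ c) (inj₁ c′) = ⟦const′⟧ A ρ S _
      ⟦sameObject′⟧ (inj₁ c) (inj₂ v′) = refl
      ⟦sameObject′⟧ (inj₂ v) (inj₁ c′) = refl
      ⟦sameObject′⟧ (inj₂ v) (inj₂ v′) rewrite ρ-var v | ρ-var v′ = refl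

      collectNow-constant : ∀ {k} (w : Vec (Fin t) k) → collectVars w ≡ nothing → collectNow (lookup As j) (kinds j) w ≡ nothing
      collectNow-constant (i ∷ w) e with object i
      ... | inj₁ _ = refl
      ... | inj₂ v with collectVars w in eq
      ...   | nothing with kindAt As j (locate As (toList (X v)))
      ...     | before = refl
      ...     | later  = refl
      ...     | now _ rewrite collectNow-constant w eq = refl

      data NowView {k} (w : Vec (Fin t) k) (vs : Vec (Fin nv) k) : Set where
        notAllNow : allOf (isNow ∘ kinds j) w ≡ false → collectNow (lookup As j) (kinds j) w ≡ nothing → NowView w vs
        allNow    : allOf (isNow ∘ kinds j) w ≡ true → (ws : Vec (Fin (size (lookup As j))) k) →
                    collectNow (lookup As j) (kinds j) w ≡ just ws →
                    (∀ l → locate As (toList (X (Vec.lookup vs l))) ≡ (j , Vec.lookup ws l)) → NowView w vs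

      nowView : ∀ {k} (w : Vec (Fin t) k) vs → collectVars w ≡ just vs → NowView w vs
      nowView [] [] refl = allNow refl [] refl (λ ())
      nowView (i ∷ w) vs e with object i in eo
      nowView (i ∷ w) vs () | inj₁ _
      ... | inj₂ v with collectVars w in eq
      nowView (i ∷ w) vs () | inj₂ v | nothing
      nowView (i ∷ w) .(v ∷ vs′) refl | inj₂ v | just vs′ with locate As (toList (X v)) in el
      ...   | j′ , w′ = go (kindAt As j (j′ , w′)) ki
        where
          ki : kinds j i ≡ kindAt As j (j′ , w′)
          ki = trans (cong (maybe′ (kindAt As j) before ∘ objectPosition) eo) (cong (kindAt As j) el)
          head-isNow : ∀ {κ} → kinds j i ≡ κ → allOf (isNow ∘ kinds j) (i ∷ w) ≡ isNow κ ∧ allOf (isNow ∘ kinds j) w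
          head-isNow h = cong (λ κ → isNow κ ∧ allOf (isNow ∘ kinds j) w) h
          go : ∀ κ → kinds j i ≡ κ → NowView (i ∷ w) (v ∷ vs′)
          go before h = notAllNow (head-isNow h) (collectNow-¬now (lookup As j) (kinds j) i w (cong isNow h))
          go later  h = notAllNow (head-isNow h) (collectNow-¬now (lookup As j) (kinds j) i w (cong isNow h))
          go (now w₀) h with nowView w vs′ eq
          ... | notAllNow a b = notAllNow (trans (head-isNow h) a)
                                          (trans (collectNow-now (lookup As j) (kinds j) i w₀ w h) (cong (Maybe.map (w₀ ∷_)) b))
          ... | allNow a ws b c = allNow (trans (head-isNow h) a) (w₀ ∷ ws)
                                         (trans (collectNow-now (lookup As j) (kinds j) i w₀ w h) (cong (Maybe.map (w₀ ∷_)) b)) c′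
            where
              c′ : ∀ l → locate As (toList (X (Vec.lookup (v ∷ vs′) l))) ≡ (j , Vec.lookup (w₀ ∷ ws) l)
              c′ Fin.zero    = trans el (kindAt-now⁻ As j (j′ , w′) w₀ (trans (sym ki) h))
              c′ (Fin.suc l) = c l

      ⟦itemRel′⟧ : (a : ℕ) (R′ : Vec (Fin n) (starArity a) → Formula (starV σ) n m)
                   (R : Vec (Fin (size A)) (starArity a) → Bool) (Rᵢ : (j : Fin (length As)) → Vec (Fin (size (lookup As j))) a → Bool) →
                   (∀ vs → ⟦ R′ vs ⟧ A ρ S ≡ R (Vec.map (Vec.lookup ρ) vs)) →
                   (∀ xs → R xs ≡ starRel As a Rᵢ (Vec.map toList xs)) →
                   (w : Vec (Fin t) a) → ⟦ itemRel′ a R′ w ⟧ A ρ S ≡ maybe (Rᵢ j) false (collectNow (lookup As j) (kinds j) w)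
      ⟦itemRel′⟧ zero R′ R Rᵢ ⟦R′⟧ R-iso [] = trans (⟦R′⟧ (z ∷ [])) (trans (R-iso _) (cong (λ j′ → Rᵢ j′ []) z-j))
      ⟦itemRel′⟧ (suc a) R′ R Rᵢ ⟦R′⟧ R-iso w with collectVars w in ecv
      ... | nothing rewrite collectNow-constant w ecv = refl
      ... | just vs with nowView w vs ecv
      ...   | notAllNow notNow b rewrite b = cong₂ _∧_ (trans (⟦allOf′⟧ A ρ S now′ (isNow ∘ kinds j) ⟦now′⟧ w) notNow) refl
      ...   | allNow allNow′ ws b c rewrite b =
               trans (cong₂ _∧_ (trans (⟦allOf′⟧ A ρ S now′ (isNow ∘ kinds j) ⟦now′⟧ w) allNow′) (trans (⟦R′⟧ _) (R-iso _)))
                     (starRel-local As Rᵢ j (Vec.map toList (Vec.map (Vec.lookup ρ) (Vec.map var vs))) ws located)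
        where
          located : ∀ l → locate As (Vec.lookup (Vec.map toList (Vec.map (Vec.lookup ρ) (Vec.map var vs))) l) ≡ (j , Vec.lookup ws l)
          located l rewrite Vecₚ.lookup-map l toList (Vec.map (Vec.lookup ρ) (Vec.map var vs))
                          | Vecₚ.lookup-map l (Vec.lookup ρ) (Vec.map var vs) | Vecₚ.lookup-map l var vs
                          | ρ-var (Vec.lookup vs l) = c l

      module _ (prev : Bit → Formula (starV σ) n m) (P : Bit → Bool) (⟦prev⟧ : ∀ b → ⟦ prev b ⟧ A ρ S ≡ P b) where

        ⟦translate⟧ : ∀ {k} (ψ : Formula (γ ×v σ) k 0) (env : Vec (Fin t) k) →
                      ⟦ translate prev ψ env ⟧ A ρ S ≡ evalAbstract (lookup As j) (kinds j) P ψ env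
        ⟦translate⟧ (rel′ (inj₁ (inj₁ r)) zs) env =
          cong₂ _∧_ (⟦allOf′⟧ A ρ S before′ (isBefore ∘ kinds j) ⟦before′⟧ (Vec.map (Vec.lookup env) zs)) (⟦prev⟧ _)
        ⟦translate⟧ (rel′ (inj₁ (inj₂ r)) zs) env =
          ⟦itemRel′⟧ (arity σ r) (rel′ (inj₁ r)) (rel A (inj₁ r)) (λ j → rel (lookup As j) r) (λ vs → refl)
                     (λ xs → sym (_≅_.pres iso (inj₁ r) xs)) _
        ⟦translate⟧ (rel′ (inj₂ tt) (q ∷ [])) env = ⟦before′⟧ (Vec.lookup env q)
        ⟦translate⟧ (eq′ q q′) env = ⟦sameObject′⟧ (object (Vec.lookup env q)) (object (Vec.lookup env q′))
        ⟦translate⟧ (mem′ _ ()) env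
        ⟦translate⟧ true′      env = refl
        ⟦translate⟧ (not′ φ)   env = cong not (⟦translate⟧ φ env)
        ⟦translate⟧ (and′ φ ψ) env = cong₂ _∧_ (⟦translate⟧ φ env) (⟦translate⟧ ψ env)
        ⟦translate⟧ (or′ φ ψ)  env = cong₂ _∨_ (⟦translate⟧ φ env) (⟦translate⟧ ψ env)
        ⟦translate⟧ (ex₁ φ)    env = refl
        ⟦translate⟧ (ex₂ φ)    env = refl

        ⟦aliveAfter′⟧ : ∀ i → ⟦ aliveAfter′ prev i ⟧ A ρ S ≡ aliveAfter (lookup As j) (kinds j) P i
        ⟦aliveAfter′⟧ i = cong₂ _∧_ (cong₂ _∨_ (cong₂ _∧_ (⟦before′⟧ i) (⟦prev⟧ (inj₁ i))) (⟦now′⟧ i))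
                                    (⟦translate⟧ (univ J Fin.zero) (i ∷ []))

        ⟦step′⟧ : ∀ b → ⟦ step′ prev b ⟧ A ρ S ≡ step (lookup As j) (kinds j) P b
        ⟦step′⟧ (inj₁ i) = ⟦aliveAfter′⟧ i
        ⟦step′⟧ (inj₂ k) with lookup atoms k
        ... | r , w = cong₂ _∧_ (⟦allOf′⟧ A ρ S (aliveAfter′ prev) (aliveAfter (lookup As j) (kinds j) P) ⟦aliveAfter′⟧ w)
                                (⟦translate⟧ (rels J r (idComponents w)) (idFlatten (idComponents w) w))

-- Definability of the run

-- The sets are checked at the first item against the initial state and at every other item
-- against the sets at its predecessor.
module RunFormula {σ γ : Vocab} (J : MSOInterp (γ ×v σ) γ (1 ∷ [])) (k₀ t nv : ℕ) (object : Fin t → Fin k₀ ⊎ Fin nv)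
                  (init : Atoms.Bit γ t → Bool) (target : Atoms.Bit γ t) where
  open Atoms γ t
  open StepFormula J k₀ t nv object

  nSets : ℕ
  nSets = t + nAtoms

  setOf : Bit → Fin (nSets + 0)
  setOf b = join t nAtoms b ↑ˡ 0

  forAllBits′ : ∀ {n m} → (Bit → Formula (starV σ) n m) → Formula (starV σ) n m
  forAllBits′ f = and′ (forAllFin′ t (f ∘ inj₁)) (forAllFin′ nAtoms (f ∘ inj₂))

  consistent′ : ∀ {n} (var : Fin nv → Fin n) (z : Fin n) → (Bit → Formula (starV σ) n (nSets + 0)) → Formula (starV σ) n (nSets + 0)
  consistent′ var z prev = forAllBits′ λ b → iff′ (mem′ z (setOf b)) (AtItem.step′ var z prev b)

  fromInit′ : Formula (starV σ) (suc nv) (nSets + 0)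
  fromInit′ = consistent′ Fin.suc Fin.zero (const′ ∘ init)

  fromPrevious′ : Formula (starV σ) (suc (suc nv)) (nSets + 0)
  fromPrevious′ = consistent′ (Fin.suc ∘ Fin.suc) (Fin.suc Fin.zero) (λ b → mem′ Fin.zero (setOf b))

  startsRight′ : Formula (starV σ) (suc nv) (nSets + 0)
  startsRight′ = imp′ (first′ Fin.zero) fromInit′

  stepsRight′ : Formula (starV σ) (suc (suc nv)) (nSets + 0)
  stepsRight′ = imp′ (succ′ Fin.zero (Fin.suc Fin.zero)) fromPrevious′

  validRun′ : Formula (starV σ) nv (nSets + 0)
  validRun′ = all₁ (and′ startsRight′ (all₁ stepsRight′))

  endsInTarget′ : Formula (starV σ) (suc nv) (nSets + 0)
  endsInTarget′ = and′ (last′ Fin.zero) (mem′ Fin.zero (setOf target))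

  run′ : Formula (starV σ) nv 0
  run′ = or′ (and′ (not′ (ex₁ true′)) (const′ (init target)))
             (exSets nSets (and′ validRun′ (ex₁ endsInTarget′)))

  module RunSound (As : List (Structure σ)) (A : Structure (starV σ)) (iso : A ≅ listStr As)
                  (nonempty : All (λ B → 0 < size B) As) (ρ : Vec (Fin (size A)) nv) where
    open ListOrder As A iso
    open StepFormula.Sound J k₀ t nv object As A iso (Vec.lookup ρ)
    open AbstractStep J t sameObject using (step; step-cong; runFold; runFold-empty; runUntil; runUntil-first; runUntil-next; runUntil-last)

    runAt : Fin (length As) → Bit → Bool
    runAt = runUntil init As kinds

    Sets : Set
    Sets = Vec (Vec Bool (size A)) nSets

    setBit : Sets → Fin (size A) → Bit → Bool
    setBit Xs x b = Vec.lookup (Vec.lookup Xs (join t nAtoms b)) x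

    ⟦mem′-setOf⟧ : ∀ {n} (ρ′ : Vec (Fin (size A)) n) Xs q b → ⟦ mem′ q (setOf b) ⟧ A ρ′ (Xs ++ []) ≡ setBit Xs (Vec.lookup ρ′ q) b
    ⟦mem′-setOf⟧ ρ′ Xs q b = cong (λ V → Vec.lookup V (Vec.lookup ρ′ q)) (Vecₚ.lookup-++ˡ Xs [] (join t nAtoms b))

    module _ {n : ℕ} (ρ′ : Vec (Fin (size A)) n) (Xs : Sets) (var : Fin nv → Fin n) (z : Fin n)
             (ρ′-var : ∀ v → Vec.lookup ρ′ (var v) ≡ Vec.lookup ρ v) (prev : Bit → Formula (starV σ) n (nSets + 0)) (P : Bit → Bool)
             (⟦prev⟧ : ∀ b → ⟦ prev b ⟧ A ρ′ (Xs ++ []) ≡ P b) where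

      private
        x : Fin (size A)
        x = Vec.lookup ρ′ z
        ⟦step′⟧-here : ∀ b → ⟦ AtItem.step′ var z prev b ⟧ A ρ′ (Xs ++ []) ≡ step (lookup As (item x)) (kinds (item x)) P b
        ⟦step′⟧-here = ⟦step′⟧ ρ′ (Xs ++ []) var z ρ′-var (item x) refl prev P ⟦prev⟧

      ⟦consistent′⟧⁻ : ⟦ consistent′ var z prev ⟧ A ρ′ (Xs ++ []) ≡ true →
                       ∀ b → setBit Xs x b ≡ step (lookup As (item x)) (kinds (item x)) P b
      ⟦consistent′⟧⁻ h b = trans (sym (⟦mem′-setOf⟧ ρ′ Xs z b))
        (trans (⟦iff′⟧⁻ A ρ′ (Xs ++ []) (mem′ z (setOf b)) (AtItem.step′ var z prev b) (forAllBits b)) (⟦step′⟧-here b))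
        where
          forAllBits : ∀ b → ⟦ iff′ (mem′ z (setOf b)) (AtItem.step′ var z prev b) ⟧ A ρ′ (Xs ++ []) ≡ true
          forAllBits (inj₁ i) = ⟦forAllFin′⟧⁻ A ρ′ (Xs ++ []) t _ (∧-true⁻ˡ _ h) i
          forAllBits (inj₂ k) = ⟦forAllFin′⟧⁻ A ρ′ (Xs ++ []) nAtoms _ (∧-true⁻ʳ _ h) k

      ⟦consistent′⟧⁺ : (∀ b → setBit Xs x b ≡ step (lookup As (item x)) (kinds (item x)) P b) →
                       ⟦ consistent′ var z prev ⟧ A ρ′ (Xs ++ []) ≡ true
      ⟦consistent′⟧⁺ h = ∧-true⁺ (⟦forAllFin′⟧⁺ A ρ′ (Xs ++ []) t _ (iff ∘ inj₁))
                                 (⟦forAllFin′⟧⁺ A ρ′ (Xs ++ []) nAtoms _ (iff ∘ inj₂))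
        where
          iff : ∀ b → ⟦ iff′ (mem′ z (setOf b)) (AtItem.step′ var z prev b) ⟧ A ρ′ (Xs ++ []) ≡ true
          iff b = ⟦iff′⟧⁺ A ρ′ (Xs ++ []) (mem′ z (setOf b)) (AtItem.step′ var z prev b)
                          (trans (⟦mem′-setOf⟧ ρ′ Xs z b) (trans (h b) (sym (⟦step′⟧-here b))))

    module _ (Xs : Sets) (valid : ⟦ validRun′ ⟧ A ρ (Xs ++ []) ≡ true) where

      private
        rule : ∀ x → ⟦ and′ startsRight′ (all₁ stepsRight′) ⟧ A (x ∷ ρ) (Xs ++ []) ≡ true
        rule = ⟦all₁⟧⁻ A ρ (Xs ++ []) (and′ startsRight′ (all₁ stepsRight′)) valid

        fromInit : ∀ x → index x ≡ 0 → ⟦ fromInit′ ⟧ A (x ∷ ρ) (Xs ++ []) ≡ true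
        fromInit x e = ⟦imp′⟧⁻ A (x ∷ ρ) (Xs ++ []) (first′ Fin.zero) fromInit′ (∧-true⁻ˡ _ (rule x))
                               (⟦first′⟧⁺ nonempty (x ∷ ρ) (Xs ++ []) Fin.zero e)

        fromPrevious : ∀ x y → index x ≡ suc (index y) → ⟦ fromPrevious′ ⟧ A (y ∷ x ∷ ρ) (Xs ++ []) ≡ true
        fromPrevious x y e =
          ⟦imp′⟧⁻ A (y ∷ x ∷ ρ) (Xs ++ []) (succ′ Fin.zero (Fin.suc Fin.zero)) fromPrevious′
                  (⟦all₁⟧⁻ A (x ∷ ρ) (Xs ++ []) stepsRight′ (∧-true⁻ʳ (⟦ startsRight′ ⟧ A (x ∷ ρ) (Xs ++ [])) (rule x)) y)
                  (⟦succ′⟧⁺ nonempty (y ∷ x ∷ ρ) (Xs ++ []) Fin.zero (Fin.suc Fin.zero) e)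

      validRun-unique : ∀ k x → index x ≡ k → ∀ b → setBit Xs x b ≡ runAt (item x) b
      validRun-unique zero x e b =
        trans (⟦consistent′⟧⁻ (x ∷ ρ) Xs Fin.suc Fin.zero (λ v → refl) (const′ ∘ init) init
                              (⟦const′⟧ A (x ∷ ρ) (Xs ++ []) ∘ init) (fromInit x e) b)
              (sym (runUntil-first init As kinds (item x) e b))
      validRun-unique (suc k) x e b =
        trans (⟦consistent′⟧⁻ (y ∷ x ∷ ρ) Xs (Fin.suc ∘ Fin.suc) (Fin.suc Fin.zero) (λ v → refl) (λ b → mem′ Fin.zero (setOf b))
                              (setBit Xs y) (⟦mem′-setOf⟧ (y ∷ x ∷ ρ) Xs Fin.zero) (fromPrevious x y x=y+1) b)
              (trans (step-cong (lookup As (item x)) (kinds (item x)) (validRun-unique k y y=k) b)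
                     (sym (runUntil-next init As kinds (item y) (item x) x=y+1 b)))
        where
          y : Fin (size A)
          y = proj₁ (elementBefore nonempty x k e)
          y=k : index y ≡ k
          y=k = proj₂ (elementBefore nonempty x k e)
          x=y+1 : index x ≡ suc (index y)
          x=y+1 = trans e (cong suc (sym y=k))

    canonicalSets : Sets
    canonicalSets = Vec.tabulate λ s → Vec.tabulate λ x → runAt (item x) (splitAt t s)

    setBit-canonical : ∀ x b → setBit canonicalSets x b ≡ runAt (item x) b
    setBit-canonical x b
      rewrite Vecₚ.lookup∘tabulate (λ s → Vec.tabulate λ x → runAt (item x) (splitAt t s)) (join t nAtoms b)
            | Vecₚ.lookup∘tabulate (λ x → runAt (item x) (splitAt t (join t nAtoms b))) x
            | Finₚ.splitAt-join t nAtoms b = refl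

    validRun-canonical : ⟦ validRun′ ⟧ A ρ (canonicalSets ++ []) ≡ true
    validRun-canonical = ⟦all₁⟧⁺ A ρ (canonicalSets ++ []) (and′ startsRight′ (all₁ stepsRight′)) λ x →
      ∧-true⁺ (⟦imp′⟧⁺ A (x ∷ ρ) (canonicalSets ++ []) (first′ Fin.zero) fromInit′ λ isFirst →
                 ⟦consistent′⟧⁺ (x ∷ ρ) canonicalSets Fin.suc Fin.zero (λ v → refl) (const′ ∘ init) init
                   (⟦const′⟧ A (x ∷ ρ) (canonicalSets ++ []) ∘ init) λ b →
                   trans (setBit-canonical x b)
                         (runUntil-first init As kinds (item x) (⟦first′⟧⁻ nonempty (x ∷ ρ) (canonicalSets ++ []) Fin.zero isFirst) b))
              (⟦all₁⟧⁺ A (x ∷ ρ) (canonicalSets ++ []) stepsRight′ λ y →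
                 ⟦imp′⟧⁺ A (y ∷ x ∷ ρ) (canonicalSets ++ []) (succ′ Fin.zero (Fin.suc Fin.zero)) fromPrevious′ λ isSucc →
                   ⟦consistent′⟧⁺ (y ∷ x ∷ ρ) canonicalSets (Fin.suc ∘ Fin.suc) (Fin.suc Fin.zero) (λ v → refl)
                     (λ b → mem′ Fin.zero (setOf b)) (setBit canonicalSets y) (⟦mem′-setOf⟧ (y ∷ x ∷ ρ) canonicalSets Fin.zero) λ b →
                     trans (setBit-canonical x b)
                       (trans (runUntil-next init As kinds (item y) (item x)
                                 (⟦succ′⟧⁻ nonempty (y ∷ x ∷ ρ) (canonicalSets ++ []) Fin.zero (Fin.suc Fin.zero) isSucc) b)
                              (step-cong (lookup As (item x)) (kinds (item x)) (sym ∘ setBit-canonical y) b)))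

    ⟦run′⟧-empty : length As ≡ 0 → ⟦ run′ ⟧ A ρ [] ≡ runFold init As kinds target
    ⟦run′⟧-empty e =
      trans (cong₂ (λ a c → (not a ∧ ⟦ const′ (init target) ⟧ A ρ []) ∨ c) (¬true⇒false noElement) (¬true⇒false noRun))
            (trans (trans (∨-identityʳ _) (⟦const′⟧ A ρ [] (init target))) (sym (runFold-empty init As kinds e target)))
      where
        noItem : Fin (size A) → ⊥
        noItem x with subst Fin e (item x)
        ... | ()
        noElement : ⟦ ex₁ true′ ⟧ A ρ [] ≢ true
        noElement h = noItem (proj₁ (⟦ex₁⟧⁻ A ρ [] true′ h))
        noRun : ⟦ exSets nSets (and′ validRun′ (ex₁ endsInTarget′)) ⟧ A ρ [] ≢ true
        noRun h with ⟦exSets⟧⁻ A ρ nSets (and′ validRun′ (ex₁ endsInTarget′)) [] h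
        ... | Xs , body = noItem (proj₁ (⟦ex₁⟧⁻ A ρ (Xs ++ []) endsInTarget′ (∧-true⁻ʳ (⟦ validRun′ ⟧ A ρ (Xs ++ [])) body)))

    ⟦run′⟧-nonempty : 0 < length As → ⟦ run′ ⟧ A ρ [] ≡ runFold init As kinds target
    ⟦run′⟧-nonempty pos rewrite ⟦ex₁⟧⁺ A ρ [] true′ (proj₁ (elementAt nonempty 0 pos)) refl = true⇔true⇒≡ sound complete
      where
        sound : ⟦ exSets nSets (and′ validRun′ (ex₁ endsInTarget′)) ⟧ A ρ [] ≡ true → runFold init As kinds target ≡ true
        sound h with ⟦exSets⟧⁻ A ρ nSets (and′ validRun′ (ex₁ endsInTarget′)) [] h
        ... | Xs , body with ⟦ex₁⟧⁻ A ρ (Xs ++ []) endsInTarget′ (∧-true⁻ʳ (⟦ validRun′ ⟧ A ρ (Xs ++ [])) body)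
        ...   | z , ends = begin
          runFold init As kinds target  ≡⟨ runUntil-last init As kinds (item z) isLast target ⟩
          runAt (item z) target         ≡⟨ validRun-unique Xs (∧-true⁻ˡ _ body) (index z) z refl target ⟨
          setBit Xs z target            ≡⟨ ⟦mem′-setOf⟧ (z ∷ ρ) Xs Fin.zero target ⟨
          ⟦ mem′ Fin.zero (setOf target) ⟧ A (z ∷ ρ) (Xs ++ []) ≡⟨ ∧-true⁻ʳ (⟦ last′ Fin.zero ⟧ A (z ∷ ρ) (Xs ++ [])) ends ⟩
          true                          ∎
          where
            open ≡-Reasoning
            isLast = ⟦last′⟧⁻ nonempty (z ∷ ρ) (Xs ++ []) Fin.zero (∧-true⁻ˡ (⟦ last′ Fin.zero ⟧ A (z ∷ ρ) (Xs ++ [])) ends)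
        complete : runFold init As kinds target ≡ true → ⟦ exSets nSets (and′ validRun′ (ex₁ endsInTarget′)) ⟧ A ρ [] ≡ true
        complete h = ⟦exSets⟧⁺ A ρ nSets (and′ validRun′ (ex₁ endsInTarget′)) [] canonicalSets
          (∧-true⁺ validRun-canonical (⟦ex₁⟧⁺ A ρ (canonicalSets ++ []) endsInTarget′ z (∧-true⁺
            (⟦last′⟧⁺ nonempty (z ∷ ρ) (canonicalSets ++ []) Fin.zero isLast)
            (trans (⟦mem′-setOf⟧ (z ∷ ρ) canonicalSets Fin.zero target)
                   (trans (setBit-canonical z target) (trans (sym (runUntil-last init As kinds (item z) isLast target)) h))))))
          where
            z : Fin (size A)
            z = proj₁ (lastElement nonempty pos)
            isLast : suc (index z) ≡ length As
            isLast = proj₂ (lastElement nonempty pos)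

    ⟦run′⟧ : ⟦ run′ ⟧ A ρ [] ≡ runFold init As kinds target
    ⟦run′⟧ = byLength (length As) refl
      where
        byLength : ∀ n → length As ≡ n → ⟦ run′ ⟧ A ρ [] ≡ runFold init As kinds target
        byLength zero    e = ⟦run′⟧-empty e
        byLength (suc n) e = ⟦run′⟧-nonempty (subst (0 <_) (sym e) (s≤s z≤n))

≡true-Σ-≡ : ∀ {X : Set} {P : X → Bool} {x y : X} {h₁ : P x ≡ true} {h₂ : P y ≡ true} → x ≡ y →
            _≡_ {A = Σ X λ x → P x ≡ true} (x , h₁) (y , h₂)
≡true-Σ-≡ {h₁ = h₁} {h₂} refl = cong (_ ,_) (≡true-irrelevant h₁ h₂)

extract : ∀ {X : Set} (m : Maybe X) → is-just m ≡ true → X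
extract (just x) _ = x

extract-≡ : ∀ {X : Set} (m : Maybe X) h x → m ≡ just x → extract m h ≡ x
extract-≡ (just x) h .x refl = refl

extract-just : ∀ {X : Set} (m : Maybe X) h → m ≡ just (extract m h)
extract-just (just x) h = refl

-- The k components of dimension 0 of the functor A¹ + k·A⁰ stand for the constants Fin k.
Constant : ℕ → Set
Constant k = Fin (length (List.replicate k 0))

constantOf : ∀ k → Constant k → Fin k
constantOf (suc k) Fin.zero    = Fin.zero
constantOf (suc k) (Fin.suc c) = Fin.suc (constantOf k c)

componentOf : ∀ k → Fin k → Constant k
componentOf (suc k) Fin.zero    = Fin.zero
componentOf (suc k) (Fin.suc c) = Fin.suc (componentOf k c)

noArguments : ∀ {X : Set} k (c : Constant k) → Vec X (lookup (List.replicate k 0) c)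
noArguments (suc k) Fin.zero    = []
noArguments (suc k) (Fin.suc c) = noArguments k c

constantOf-componentOf : ∀ k (c : Fin k) → constantOf k (componentOf k c) ≡ c
constantOf-componentOf (suc k) Fin.zero    = refl
constantOf-componentOf (suc k) (Fin.suc c) = cong Fin.suc (constantOf-componentOf k c)

componentOf-constantOf : ∀ {X : Set} k (c : Constant k) (v : Vec X (lookup (List.replicate k 0) c)) →
  _≡_ {A = Σ (Constant k) λ c → Vec X (lookup (List.replicate k 0) c)}
      (componentOf k (constantOf k c) , noArguments k (componentOf k (constantOf k c))) (c , v)
componentOf-constantOf     (suc k) Fin.zero    [] = refl
componentOf-constantOf {X} (suc k) (Fin.suc c) v  =
  cong {A = Σ (Constant k) λ c → Vec X (lookup (List.replicate k 0) c)}
       (λ { (c′ , v′) → Fin.suc c′ , v′ }) (componentOf-constantOf k c v)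

constantFormula : ∀ {τ : Vocab} k → (Fin k → Formula τ 0 0) → (c : Constant k) → Formula τ (lookup (List.replicate k 0) c) 0
constantFormula (suc k) g Fin.zero    = g Fin.zero
constantFormula (suc k) g (Fin.suc c) = constantFormula k (g ∘ Fin.suc) c

⟦constantFormula⟧ : ∀ {τ : Vocab} k (g : Fin k → Formula τ 0 0) (c : Constant k) (A : Structure τ)
  (v : Vec (Fin (size A)) (lookup (List.replicate k 0) c)) → ⟦ constantFormula k g c ⟧ A v [] ≡ ⟦ g (constantOf k c) ⟧ A [] []
⟦constantFormula⟧ (suc k) g Fin.zero    A [] = refl
⟦constantFormula⟧ (suc k) g (Fin.suc c) A v  = ⟦constantFormula⟧ k (g ∘ Fin.suc) c A v

module FoldInterpretation {σ γ : Vocab} (Σc : Class σ) (Γc : Class γ) (B₀ : Structure γ) (b₀ : member Γc B₀)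
    (δ : (C : Structure (γ ×v σ)) → C ∈× (Γc , Σc) → Structure γ)
    (δ∈ : (C : Structure (γ ×v σ)) (p : C ∈× (Γc , Σc)) → member Γc (δ C p))
    (J : MSOInterp (γ ×v σ) γ (1 ∷ [])) (qfJ : IsQF J)
    (J-δ : ∀ (C : Structure (γ ×v σ)) (p : C ∈× (Γc , Σc)) → Produces J C (δ C p)) where

  open Tracking Σc Γc δ δ∈ J J-δ

  k₀ : ℕ
  k₀ = size B₀

  initialElement : ∀ {t nv} → (Fin t → Fin k₀ ⊎ Fin nv) → Fin t → Maybe (Fin k₀)
  initialElement object i = Sum.[ just , (λ _ → nothing) ] (object i)

  initialState : ∀ t nv (object : Fin t → Fin k₀ ⊎ Fin nv) → Atoms.Bit γ t → Bool
  initialState t nv object = Observation.observe γ t B₀ (initialElement object)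

  runFor : ∀ t nv (object : Fin t → Fin k₀ ⊎ Fin nv) (target : Atoms.Bit γ t) → Formula (starV σ) nv 0
  runFor t nv object target = RunFormula.run′ J k₀ t nv object (initialState t nv object) target

  F : PolyFunctor
  F = 1 ∷ List.replicate k₀ 0

  F-linear : Linear F
  F-linear = s≤s z≤n ∷ replicate⁺ k₀ z≤n

  objectOf : ∀ {m} (c : Vec (Comp F) m) → Fin m → Fin k₀ ⊎ Fin (dimTuple F c)
  objectOf (Fin.zero   ∷ c) Fin.zero    = inj₂ Fin.zero
  objectOf (Fin.suc c₀ ∷ c) Fin.zero    = inj₁ (constantOf k₀ c₀)
  objectOf (Fin.zero   ∷ c) (Fin.suc i) = Sum.map₂ Fin.suc (objectOf c i)
  objectOf (Fin.suc c₀ ∷ c) (Fin.suc i) = Sum.map₂ (lookup (List.replicate k₀ 0) c₀ ↑ʳ_) (objectOf c i)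

  alive : ∀ {t} → Fin t → Atoms.Bit γ t
  alive = inj₁

  univ′ : (i : Comp F) → Formula (starV σ) (lookup F i) 0
  univ′ Fin.zero    = runFor 1 1 (λ _ → inj₂ Fin.zero) (alive Fin.zero)
  univ′ (Fin.suc c) = constantFormula k₀ (λ c′ → runFor 1 0 (λ _ → inj₁ c′) (alive Fin.zero)) c

  relationAtom : (r : Name γ) → Atoms.Bit γ (arity γ r)
  relationAtom r = inj₂ (Atoms.atomIndex γ (arity γ r) (r , Vec.allFin (arity γ r)))

  rels′ : (r : Name γ) (c : Vec (Comp F) (arity γ r)) → Formula (starV σ) (dimTuple F c) 0
  rels′ r c = runFor (arity γ r) (dimTuple F c) (objectOf c) (relationAtom r)

  I : MSOInterp (starV σ) γ F
  I = record { univ = univ′ ; rels = rels′ }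

  module Correct (A : Structure (starV σ)) (A∈ : A ∈* Σc) where
    As : List (Structure σ)
    As = proj₁ A∈

    iso : A ≅ listStr As
    iso = proj₂ (proj₂ A∈)

    as : All (member Σc) As
    as = All.map proj₂ (proj₁ (proj₂ A∈))

    nonempty : All (λ B → 0 < size B) As
    nonempty = All.map proj₁ (proj₁ (proj₂ A∈))

    open ListOrder As A iso

    Bₙ : Structure γ
    Bₙ = foldResult B₀ b₀ As as

    originOf : ∀ {nv} (X : Fin nv → Fin (size A)) → Fin k₀ ⊎ Fin nv → Origin B₀ As
    originOf X (inj₁ c) = inj₁ c
    originOf X (inj₂ v) = inj₂ (locate As (toList (X v)))

    module Agreement (t nv : ℕ) (object : Fin t → Fin k₀ ⊎ Fin nv) (target : Atoms.Bit γ t) (ρ : Vec (Fin (size A)) nv) where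
      X : Fin nv → Fin (size A)
      X = Vec.lookup ρ

      open StepFormula.Sound J k₀ t nv object As A iso X using (kinds; sameObject; sameObjectᵇ)
      open AbstractRunSound Σc Γc δ δ∈ J qfJ J-δ t sameObject using (Faithful; observe-fold≡runFold)
      open AbstractStep J t sameObject using (runFold-cong)
      open Observation γ t

      cur₀ : Fin t → Maybe (Origin B₀ As)
      cur₀ i = just (originOf X (object i))

      kinds-cur₀ : ∀ j i → kinds j i ≡ kindsOf As (pendingPosition {B₀} {As} ∘ cur₀) j i
      kinds-cur₀ j i with object i
      ... | inj₁ _ = refl
      ... | inj₂ _ = refl

      sameObjectᵇ-origin : ∀ u u′ → (sameObjectᵇ u u′ ≡ true → originOf X u ≡ originOf X u′) ×
                                    (originOf X u ≡ originOf X u′ → sameObjectᵇ u u′ ≡ true)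
      sameObjectᵇ-origin (inj₁ c) (inj₁ c′) with c Finₚ.≟ c′
      ... | yes refl = (λ _ → refl) , (λ _ → refl)
      ... | no c≢c′  = (λ ()) , (λ { refl → ⊥-elim (c≢c′ refl) })
      sameObjectᵇ-origin (inj₁ c) (inj₂ v′) = (λ ()) , (λ ())
      sameObjectᵇ-origin (inj₂ v) (inj₁ c′) = (λ ()) , (λ ())
      sameObjectᵇ-origin (inj₂ v) (inj₂ v′) = to , from
        where
          to : (toℕ (X v) ≡ᵇ toℕ (X v′)) ≡ true → originOf X (inj₂ v) ≡ originOf X (inj₂ v′)
          to e = cong (λ x → inj₂ (locate As (toList x))) (Finₚ.toℕ-injective (ℕₚ.≡ᵇ⇒≡ _ _ (Equivalence.from T-≡ e)))
          from : originOf X (inj₂ v) ≡ originOf X (inj₂ v′) → (toℕ (X v) ≡ᵇ toℕ (X v′)) ≡ true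
          from e = Equivalence.to T-≡ (ℕₚ.≡⇒≡ᵇ (toℕ (X v)) (toℕ (X v′)) (cong toℕ Xv≡Xv′))
            where
              Xv≡Xv′ : X v ≡ X v′
              Xv≡Xv′ = trans (sym (fromList-embed-locate (X v)))
                             (trans (cong (fromList ∘ embed As) (inj₂-injective e)) (fromList-embed-locate (X v′)))

      faithful₀ : Faithful {B₀} {As} cur₀
      faithful₀ i k s s′ refl refl = sameObjectᵇ-origin (object i) (object k)

      initialState-cur₀ : ∀ b → initialState t nv object b ≡ observe B₀ (currentElement {B₀} {As} ∘ cur₀) b
      initialState-cur₀ = observe-cong B₀ λ i → lemma (object i)
        where
          lemma : ∀ u → Sum.[ just , (λ _ → nothing) ] u ≡ currentElement {B₀} {As} (just (originOf X u))
          lemma (inj₁ _) = refl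
          lemma (inj₂ _) = refl

      ⟦runFor⟧ : ⟦ runFor t nv object target ⟧ A ρ [] ≡ observe Bₙ (λ i → cur₀ i >>= track B₀ b₀ As as) target
      ⟦runFor⟧ = begin
        ⟦ runFor t nv object target ⟧ A ρ []                                   ≡⟨ RunFormula.RunSound.⟦run′⟧ J k₀ t nv object
                                                                                    (initialState t nv object) target As A iso nonempty ρ ⟩
        runFold (initialState t nv object) As kinds target                      ≡⟨ runFold-cong initialState-cur₀ As kinds target ⟩
        runFold (observe B₀ (currentElement {B₀} {As} ∘ cur₀)) As kinds target ≡⟨ observe-fold≡runFold B₀ b₀ As as cur₀ kinds
                                                                                    kinds-cur₀ faithful₀ target ⟨
        observe Bₙ (λ i → cur₀ i >>= track B₀ b₀ As as) target                 ∎
        where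
          open ≡-Reasoning
          open AbstractStep J t sameObject using (runFold)

    originOfEl : El F (size A) → Origin B₀ As
    originOfEl (Fin.zero  , x ∷ []) = inj₂ (locate As (toList x))
    originOfEl (Fin.suc c , v)      = inj₁ (constantOf k₀ c)

    elOfOrigin : Origin B₀ As → El F (size A)
    elOfOrigin (inj₁ c) = Fin.suc (componentOf k₀ c) , noArguments k₀ (componentOf k₀ c)
    elOfOrigin (inj₂ q) = Fin.zero , fromList (embed As q) ∷ []

    originOfEl-elOfOrigin : ∀ o → originOfEl (elOfOrigin o) ≡ o
    originOfEl-elOfOrigin (inj₁ c) = cong inj₁ (constantOf-componentOf k₀ c)
    originOfEl-elOfOrigin (inj₂ q) = cong inj₂ (locate-toList-fromList q)

    elOfOrigin-originOfEl : ∀ e → elOfOrigin (originOfEl e) ≡ e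
    elOfOrigin-originOfEl (Fin.zero , x ∷ []) = cong (λ y → Fin.zero , y ∷ []) (fromList-embed-locate x)
    elOfOrigin-originOfEl (Fin.suc c , v) =
      cong {A = Σ (Constant k₀) λ c → Vec (Fin (size A)) (lookup (List.replicate k₀ 0) c)} {B = El F (size A)}
           (λ { (c′ , v′) → Fin.suc c′ , v′ }) (componentOf-constantOf k₀ c v)

    inUniv-track : ∀ e → inUniv I A e ≡ is-just (track B₀ b₀ As as (originOfEl e))
    inUniv-track (Fin.zero , x ∷ []) = Agreement.⟦runFor⟧ 1 1 (λ _ → inj₂ Fin.zero) (alive Fin.zero) (x ∷ [])
    inUniv-track (Fin.suc c , v) =
      trans (⟦constantFormula⟧ k₀ (λ c′ → runFor 1 0 (λ _ → inj₁ c′) (alive Fin.zero)) c A v)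
            (Agreement.⟦runFor⟧ 1 0 (λ _ → inj₁ (constantOf k₀ c)) (alive Fin.zero) [])

    Universe : Set
    Universe = Σ (El F (size A)) λ e → inUniv I A e ≡ true

    track-originOfEl : ∀ b → track B₀ b₀ As as (originOfEl (elOfOrigin (origin B₀ b₀ As as b))) ≡ just b
    track-originOfEl b = trans (cong (track B₀ b₀ As as) (originOfEl-elOfOrigin _)) (track-origin B₀ b₀ As as b)

    toUniverse : Fin (size Bₙ) → Universe
    toUniverse b = elOfOrigin (origin B₀ b₀ As as b) , trans (inUniv-track _) (cong is-just (track-originOfEl b))

    fromUniverse : Universe → Fin (size Bₙ)
    fromUniverse (e , h) = extract (track B₀ b₀ As as (originOfEl e)) (trans (sym (inUniv-track e)) h)

    toUniverse-fromUniverse : ∀ y → toUniverse (fromUniverse y) ≡ y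
    toUniverse-fromUniverse (e , h) = ≡true-Σ-≡ {P = inUniv I A}
      (trans (cong elOfOrigin (origin-track B₀ b₀ As as (originOfEl e) _
                                 (extract-just (track B₀ b₀ As as (originOfEl e)) (trans (sym (inUniv-track e)) h))))
             (elOfOrigin-originOfEl e))

    fromUniverse-toUniverse : ∀ b → fromUniverse (toUniverse b) ≡ b
    fromUniverse-toUniverse b = extract-≡ (track B₀ b₀ As as (originOfEl (elOfOrigin (origin B₀ b₀ As as b)))) _ b (track-originOfEl b)

    universe↔ : Fin (size Bₙ) ↔ Universe
    universe↔ = mk↔ₛ′ toUniverse fromUniverse toUniverse-fromUniverse fromUniverse-toUniverse

    originOf-flatten : ∀ {m} (es : Vec (El F (size A)) m) (i : Fin m) →
                       originOf (Vec.lookup (flatten {F} es)) (objectOf (Vec.map proj₁ es) i) ≡ originOfEl (Vec.lookup es i)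
    originOf-flatten ((Fin.zero   , x ∷ []) ∷ es) Fin.zero = refl
    originOf-flatten ((Fin.suc c₀ , v)      ∷ es) Fin.zero = refl
    originOf-flatten ((Fin.zero   , x ∷ []) ∷ es) (Fin.suc i) = trans (shift (objectOf (Vec.map proj₁ es) i)) (originOf-flatten es i)
      where
        shift : ∀ u → originOf (Vec.lookup (x ∷ flatten {F} es)) (Sum.map₂ Fin.suc u) ≡ originOf (Vec.lookup (flatten {F} es)) u
        shift (inj₁ _) = refl
        shift (inj₂ _) = refl
    originOf-flatten ((Fin.suc c₀ , v) ∷ es) (Fin.suc i) = trans (shift (objectOf (Vec.map proj₁ es) i)) (originOf-flatten es i)
      where
        shift : ∀ u → originOf (Vec.lookup (v ++ flatten {F} es)) (Sum.map₂ (lookup (List.replicate k₀ 0) c₀ ↑ʳ_) u)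
                      ≡ originOf (Vec.lookup (flatten {F} es)) u
        shift (inj₁ _) = refl
        shift (inj₂ w) = cong (λ y → inj₂ (locate As (toList y))) (Vecₚ.lookup-++ʳ v (flatten {F} es) w)

    rel-relHolds : ∀ (r : Name γ) (xs : Vec (Fin (size Bₙ)) (arity γ r)) →
                   rel Bₙ r xs ≡ relHolds I A r (Vec.map (proj₁ ∘ toUniverse) xs)
    rel-relHolds r xs = sym (begin
      relHolds I A r es                                            ≡⟨ Agree.⟦runFor⟧ ⟩
      observe Bₙ current (relationAtom r)                          ≡⟨ observe-atom Bₙ current (r , Vec.allFin (arity γ r)) ⟩
      maybe (rel Bₙ r) false (allJust (Vec.map current (Vec.allFin (arity γ r))))
                                                                   ≡⟨ cong (maybe (rel Bₙ r) false) (allJust-tabulate current xs current-xs) ⟩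
      rel Bₙ r xs                                                  ∎)
      where
        open ≡-Reasoning
        es : Vec (El F (size A)) (arity γ r)
        es = Vec.map (proj₁ ∘ toUniverse) xs
        module Agree = Agreement (arity γ r) (dimTuple F (Vec.map proj₁ es)) (objectOf (Vec.map proj₁ es)) (relationAtom r) (flatten {F} es)
        open Observation γ (arity γ r)
        current : Fin (arity γ r) → Maybe (Fin (size Bₙ))
        current i = Agree.cur₀ i >>= track B₀ b₀ As as
        current-xs : ∀ i → current i ≡ just (Vec.lookup xs i)
        current-xs i = trans (cong (track B₀ b₀ As as) (originOf-flatten es i))
                             (trans (cong (track B₀ b₀ As as ∘ originOfEl) (Vecₚ.lookup-map i (proj₁ ∘ toUniverse) xs))
                                    (track-originOfEl (Vec.lookup xs i)))

    produces : Produces I A Bₙ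
    produces = record { bij = universe↔ ; pres = rel-relHolds }

theorem1 : {σ γ : Vocab} (Σc : Class σ) (Γc : Class γ)
    (B₀ : Structure γ) (b₀ : member Γc B₀)
    (δ : (C : Structure (γ ×v σ)) → C ∈× (Γc , Σc) → Structure γ)
    (δ∈ : (C : Structure (γ ×v σ)) (p : C ∈× (Γc , Σc)) → member Γc (δ C p)) →
    (Σ (MSOInterp (γ ×v σ) γ (1 ∷ [])) λ J →
       IsQF J × (∀ (C : Structure (γ ×v σ)) (p : C ∈× (Γc , Σc)) → Produces J C (δ C p))) →
    Σ PolyFunctor λ F → Σ (MSOInterp (starV σ) γ F) λ I →
      Linear F ×
      (∀ (A : Structure (starV σ)) (p : A ∈* Σc) → Produces I A (foldFun Σc Γc δ δ∈ B₀ b₀ A p))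
theorem1 Σc Γc B₀ b₀ δ δ∈ (J , qfJ , J-δ) = F , I , F-linear , Correct.produces
  where open FoldInterpretation Σc Γc B₀ b₀ δ δ∈ J qfJ J-δ
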